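{- Let $p\equiv 1\pmod 4$ be prime and let $G_p$ be the Paley graph on $\mathbb{F}_p$, which is $d$-regular with $d=\frac{p-1}{2}$; let $\lambda_1,\dots,\lambda_p$ be its adjacency eigenvalues (with multiplicity). Then the adjacency spectrum of the symmetric lift $\mathrm{HL}'_2(G_p)$ is the multiset \[\mathrm{Spec}(\mathrm{HL}'_2(G_p))=\{d-2+\lambda_i,\ d-2-\lambda_i\}_{i=1}^p\cup\{ -2\}^{\times m},\qquad m=\tfrac{p(p-1)}{2}-2p,\] where $\{ -2\}^{\times m}$ denotes the eigenvalue $-2$ with multiplicity $m$.
   Context: The Paley graph $G_p$ has vertex set $\mathbb{F}_p$, with $x\ne y$ adjacent iff $x-y$ is a nonzero quadratic residue mod $p$. Symmetric lift: for a finite simple graph $G=(V,E)$, $B_{\mathrm{HL}'}(G)$ is the bipartite graph on $V'\sqcup V''$ (two disjoint copies of $V$) with edges $u'v''$ and $v'u''$ for each $\{u,v\}\in E$, and $\mathrm{HL}'_2(G)=L(B_{\mathrm{HL}'}(G))$ is its line graph; its vertices are ordered pairs $(u,v)$ with $\{u,v\}\in E$, and distinct $(u,v),(x,y)$ are adjacent iff $u=x$ or $v=y$. -}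

module Defs where

open import Data.Bool using (Bool; true; false; not; _∧_; _∨_; if_then_else_)
open import Data.Nat as ℕ using (ℕ; zero; suc; _≡ᵇ_; NonZero)
open import Data.Nat.DivMod using (_%_)
open import Data.Fin as Fin using (Fin; toℕ; punchIn)
open import Data.List as List using (List; []; _∷_; upTo; allFin; cartesianProduct; filterᵇ; foldr; length; lookup)
open import Data.Bool.ListAction using (any)
open import Data.Product using (_×_; _,_)
open import Data.Integer as ℤ using (ℤ; +_; -_; _-_; _*_; _+_)

Graph : ℕ → Set
Graph n = Fin n → Fin n → Bool

_==ᶠ_ : ∀ {n} → Fin n → Fin n → Bool
x ==ᶠ y = toℕ x ≡ᵇ toℕ y

isNonzeroQR : (p : ℕ) → .{{NonZero p}} → ℕ → Bool
isNonzeroQR p a =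
  not ((a % p) ≡ᵇ 0) ∧ any (λ y → ((y ℕ.* y) % p) ≡ᵇ (a % p)) (upTo p)

-- x ≠ y adjacent iff x - y (mod p) is a nonzero quadratic residue
paley : (p : ℕ) → .{{NonZero p}} → Graph p
paley p x y = not (x ==ᶠ y) ∧ isNonzeroQR p ((toℕ x ℕ.+ (p ℕ.∸ toℕ y)) % p)

-- Symmetric lift HL'_2(G) = L(B_HL'(G)): vertices are the ordered pairs
-- (u,v) with {u,v} ∈ E, listed in a fixed order; distinct (u,v),(x,y)
-- adjacent iff u = x or v = y.

HLVertices : ∀ {n} → Graph n → List (Fin n × Fin n)
HLVertices {n} G = filterᵇ (λ { (u , v) → G u v }) (cartesianProduct (allFin n) (allFin n))

HLsize : ∀ {n} → Graph n → ℕ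
HLsize G = length (HLVertices G)

HL2 : ∀ {n} (G : Graph n) → Graph (HLsize G)
HL2 G i j with lookup (HLVertices G) i | lookup (HLVertices G) j
... | (u , v) | (x , y) = not ((u ==ᶠ x) ∧ (v ==ᶠ y)) ∧ ((u ==ᶠ x) ∨ (v ==ᶠ y))

Matrix : ℕ → Set
Matrix n = Fin n → Fin n → ℤ

sign : ℕ → ℤ
sign zero = + 1
sign (suc k) = - sign k

det : ∀ n → Matrix n → ℤ
det zero M = + 1
det (suc n) M =
  foldr _+_ (+ 0)
    (List.map (λ j → sign (toℕ j) * M Fin.zero j * det n (λ r c → M (Fin.suc r) (punchIn j c)))
              (allFin (suc n)))

boolToℤ : Bool → ℤ
boolToℤ true = + 1
boolToℤ false = + 0

adjMatrix : ∀ {n} → Graph n → Matrix n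
adjMatrix G i j = boolToℤ (G i j)

charPoly : ∀ {n} → Matrix n → ℤ → ℤ
charPoly {n} A x = det n (λ i j → (if i ==ᶠ j then x else + 0) - A i j)

_^ℤ_ : ℤ → ℕ → ℤ
x ^ℤ zero = + 1
x ^ℤ suc k = x * (x ^ℤ k)

-- HL'₂(G) is the line graph of the bipartite double cover of G, so if N is the
-- vertex-edge incidence matrix of that cover, the adjacency matrix of HL'₂(G) is
-- NᵀN - 2I. Sylvester's identity det(tI - NᵀN) = t^(|E| - 2n) det(tI - NNᵀ) moves the
-- characteristic polynomial to NNᵀ, which for a symmetric d-regular G is the block
-- matrix [[dI, A], [A, dI]]; block elimination factors det(tI - NNᵀ) as
-- det(sI + A) det(sI - A) with s = t - d. The Paley graph is symmetric because -1 is
-- a square modulo p ≡ 1 (mod 4): inversion permutes the (p - 1)/2 nonzero squares and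
-- fixes only ±1, so parity forces -1 to be one of them. It is (p - 1)/2-regular because
-- every nonzero square has exactly two square roots. The determinant identities are
-- derived from the Laplace expansion through the uniqueness of alternating multilinear
-- forms.

module Submission where

open import Defs
open import Data.Nat using (ℕ; NonZero; _∸_; _/_) renaming (_*_ to _*ℕ_)
open import Data.Nat.DivMod using (_%_)
open import Data.Nat.Primality using (Prime)
open import Data.Integer using (ℤ; +_; -_; _-_; _*_; _+_)
open import Relation.Binary.PropositionalEquality using (_≡_)

import Data.Integer.Properties as ℤP
open import Algebra.Bundles using (AbelianGroup)
open import Algebra.Properties.Group (AbelianGroup.group ℤP.+-0-abelianGroup) using (inverseʳ-unique; ∙-cancelˡ)
open import Algebra.Properties.Semiring.Sum ℤP.+-*-semiring
  using (sum; sum-cong-≗; sum-replicate-zero; ∑-distrib-+; ∑-comm; ∑-permute; *-distribˡ-sum; *-distribʳ-sum)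
open import Data.Bool using (Bool; true; false; T; T?; not; _∧_; _∨_; if_then_else_)
open import Data.Bool.Properties using (T-∧)
open import Data.Empty using (⊥-elim)
open import Data.Fin using (Fin; zero; suc; toℕ; punchIn; punchOut; _↑ˡ_; _↑ʳ_)
import Data.Fin as Fin
import Data.Fin.Permutation as Perm
import Data.Fin.Properties as FinP
import Data.Integer as ℤ
open import Data.Integer.DivMod using (_%ℕ_; _/ℕ_; n%ℕd<d; a≡a%ℕn+[a/ℕn]*n)
open import Data.Integer.Divisibility.Signed
  using (_∣_; divides; ∣m∣n⇒∣m+n; ∣m⇒∣-m; ∣n⇒∣m*n; ∣m⇒∣m*n; ∣⇒∣ᵤ; ∣ᵤ⇒∣)
open import Data.Integer.Tactic.RingSolver using (solve-∀)
open import Data.List using (List; []; _∷_; lookup; filterᵇ; cartesianProduct; allFin; upTo)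
import Data.List as List
import Data.List.Properties as ListP
open import Data.List.Membership.Propositional.Properties using (∈-lookup)
import Data.List.Relation.Unary.All as All
open import Data.List.Relation.Unary.AllPairs using (_∷_)
open import Data.List.Relation.Unary.Any.Properties using (any⁺; any⁻; applyUpTo⁺; applyUpTo⁻)
open import Data.List.Relation.Unary.Unique.Propositional using (Unique)
import Data.List.Relation.Unary.Unique.Propositional.Properties as Unique
open import Data.Nat using (zero; suc)
import Data.Nat as ℕ
import Data.Nat.Properties as ℕP
import Data.Nat.Divisibility as ℕ∣
open import Data.Nat.DivMod using (m≡m%n+[m/n]*n; m%n<n; m*n/n≡m)
open import Data.Nat.Coprimality using (prime⇒coprime; coprime-Bézout)
open import Data.Nat.GCD using (module Bézout)
open import Data.Nat.Primality using (euclidsLemma; prime⇒nonZero; ¬prime[1])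
import Data.Nat.Tactic.RingSolver as ℕ-Solver
open import Data.Product using (∃; _×_; _,_; proj₁; proj₂)
open import Data.Sum using (_⊎_; inj₁; inj₂; [_,_]′)
import Data.Sum as Sum
open import Data.Unit using (tt)
open import Data.Vec.Functional using (updateAt; insertAt; _++_)
open import Data.Vec.Functional.Properties
  using (updateAt-updates; updateAt-minimal; insertAt-lookup; insertAt-punchIn; lookup-++ˡ; lookup-++ʳ)
open import Function using (_∘_)
open import Function.Bundles using (Equivalence)
open import Relation.Binary using (tri<; tri≈; tri>)
open import Relation.Binary.PropositionalEquality
open import Relation.Nullary using (¬_; Dec; yes; no)
open import Relation.Nullary.Reflects using (ofʸ; ofⁿ)

private variable
  m n o : ℕ

-- Finite sums and the Kronecker delta

sum-≗0 : {f : Fin n → ℤ} → (∀ i → f i ≡ + 0) → sum f ≡ + 0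
sum-≗0 {n} f≗0 = trans (sum-cong-≗ f≗0) (sum-replicate-zero n)

sum-const : ∀ n c → sum (λ (_ : Fin n) → + c) ≡ + (n ℕ.* c)
sum-const zero    c = refl
sum-const (suc n) c = trans (cong (_+_ (+ c)) (sum-const n c)) (sym (ℤP.pos-+ c (n ℕ.* c)))

sum-neg : (f : Fin n → ℤ) → sum (λ i → - f i) ≡ - sum f
sum-neg {zero}  f = refl
sum-neg {suc n} f = trans (cong (_+_ (- f zero)) (sum-neg (f ∘ suc)))
                          (sym (ℤP.neg-distrib-+ (f zero) (sum (f ∘ suc))))

sum-split : ∀ n {m} (f : Fin (n ℕ.+ m) → ℤ) → sum f ≡ sum (λ i → f (i ↑ˡ m)) + sum (λ i → f (n ↑ʳ i))
sum-split zero    f = sym (ℤP.+-identityˡ _)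
sum-split (suc n) f = trans (cong (_+_ (f zero)) (sum-split n (f ∘ suc))) (sym (ℤP.+-assoc (f zero) _ _))

foldr-tabulate : (f : Fin n → ℤ) → List.foldr _+_ (+ 0) (List.tabulate f) ≡ sum f
foldr-tabulate {zero}  f = refl
foldr-tabulate {suc n} f = cong (_+_ (f zero)) (foldr-tabulate (f ∘ suc))

==ᶠ-refl : (i : Fin n) → (i ==ᶠ i) ≡ true
==ᶠ-refl zero    = refl
==ᶠ-refl (suc i) = ==ᶠ-refl i

==ᶠ-sym : (i j : Fin n) → (i ==ᶠ j) ≡ (j ==ᶠ i)
==ᶠ-sym zero    zero    = refl
==ᶠ-sym zero    (suc j) = refl
==ᶠ-sym (suc i) zero    = refl
==ᶠ-sym (suc i) (suc j) = ==ᶠ-sym i j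

==ᶠ⇒≡ : {i j : Fin n} → (i ==ᶠ j) ≡ true → i ≡ j
==ᶠ⇒≡ {i = i} {j} eq = FinP.toℕ-injective (ℕP.≡ᵇ⇒≡ (toℕ i) (toℕ j) (subst T (sym eq) _))

≢⇒==ᶠ-false : {i j : Fin n} → i ≢ j → (i ==ᶠ j) ≡ false
≢⇒==ᶠ-false {i = i} {j} i≢j with i ==ᶠ j in eq
... | true  = ⊥-elim (i≢j (==ᶠ⇒≡ eq))
... | false = refl

δ : Fin n → Fin n → ℤ
δ i j = boolToℤ (i ==ᶠ j)

δ-refl : (i : Fin n) → δ i i ≡ + 1
δ-refl i = cong boolToℤ (==ᶠ-refl i)

δ-≢ : {i j : Fin n} → i ≢ j → δ i j ≡ + 0
δ-≢ i≢j = cong boolToℤ (≢⇒==ᶠ-false i≢j)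

δ-sym : (i j : Fin n) → δ i j ≡ δ j i
δ-sym i j = cong boolToℤ (==ᶠ-sym i j)

δ-cong-injective : {m : ℕ} (f : Fin m → Fin n) → (∀ {i j} → f i ≡ f j → i ≡ j) → ∀ i j → δ (f i) (f j) ≡ δ i j
δ-cong-injective f f-inj i j with i Fin.≟ j
... | yes refl = trans (δ-refl (f i)) (sym (δ-refl i))
... | no i≢j   = trans (δ-≢ (i≢j ∘ f-inj)) (sym (δ-≢ i≢j))

↑ˡ≢↑ʳ : ∀ {m} (u : Fin n) (v : Fin m) → u ↑ˡ m ≢ n ↑ʳ v
↑ˡ≢↑ʳ {n} {m} u v eq = ℕP.<⇒≢ (ℕP.<-≤-trans (FinP.toℕ<n u) (ℕP.m≤m+n n (toℕ v)))
  (trans (sym (FinP.toℕ-↑ˡ u m)) (trans (cong toℕ eq) (FinP.toℕ-↑ʳ n v)))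

δ-↑ˡ-↑ʳ : ∀ {m} (u : Fin n) (v : Fin m) → δ (u ↑ˡ m) (n ↑ʳ v) ≡ + 0
δ-↑ˡ-↑ʳ u v = δ-≢ (↑ˡ≢↑ʳ u v)

δ-↑ʳ-↑ˡ : ∀ {m} (u : Fin n) (v : Fin m) → δ (n ↑ʳ v) (u ↑ˡ m) ≡ + 0
δ-↑ʳ-↑ˡ u v = δ-≢ (↑ˡ≢↑ʳ u v ∘ sym)

sum-δˡ : (k : Fin n) (f : Fin n → ℤ) → sum (λ j → δ k j * f j) ≡ f k
sum-δˡ zero    f = trans (cong₂ _+_ (ℤP.*-identityˡ (f zero)) (sum-≗0 (λ j → ℤP.*-zeroˡ (f (suc j)))))
                         (ℤP.+-identityʳ (f zero))
sum-δˡ (suc k) f = trans (cong (_+ sum (λ j → δ k j * f (suc j))) (ℤP.*-zeroˡ (f zero)))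
                         (trans (ℤP.+-identityˡ _) (sum-δˡ k (f ∘ suc)))

sum-δʳ : (k : Fin n) (f : Fin n → ℤ) → sum (λ j → δ j k * f j) ≡ f k
sum-δʳ k f = trans (sum-cong-≗ (λ j → cong (_* f j) (δ-sym j k))) (sum-δˡ k f)

δ*-refl : (i : Fin n) (x : ℤ) → δ i i * x ≡ x
δ*-refl i x = trans (cong (_* x) (δ-refl i)) (ℤP.*-identityˡ x)

δ*-≢ : {i j : Fin n} (x : ℤ) → i ≢ j → δ i j * x ≡ + 0
δ*-≢ x i≢j = trans (cong (_* x) (δ-≢ i≢j)) (ℤP.*-zeroˡ x)

sum-linear : (a b : ℤ) (f g : Fin n → ℤ) → sum (λ j → a * f j + b * g j) ≡ a * sum f + b * sum g
sum-linear a b f g =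
  trans (∑-distrib-+ (λ j → a * f j) (λ j → b * g j)) (sym (cong₂ _+_ (*-distribˡ-sum a f) (*-distribˡ-sum b g)))

sum-single : (f : Fin n → ℤ) (k : Fin n) → (∀ j → j ≢ k → f j ≡ + 0) → sum f ≡ f k
sum-single f k vanish = trans (sum-cong-≗ f≗) (sum-δˡ k (λ _ → f k))
  where
  f≗ : ∀ j → f j ≡ δ k j * f k
  f≗ j with j Fin.≟ k
  ... | yes refl = sym (δ*-refl j (f j))
  ... | no j≢k   = trans (vanish j j≢k) (sym (δ*-≢ (f k) (j≢k ∘ sym)))

sum-pair : (f : Fin n → ℤ) {k k' : Fin n} → k ≢ k' →
           (∀ j → j ≢ k → j ≢ k' → f j ≡ + 0) → sum f ≡ f k + f k'
sum-pair f {k} {k'} k≢k' vanish = begin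
  sum f                                      ≡⟨ sum-cong-≗ f≗ ⟩
  sum (λ j → δ k j * f k + δ k' j * f k')    ≡⟨ ∑-distrib-+ (λ j → δ k j * f k) (λ j → δ k' j * f k') ⟩
  sum (λ j → δ k j * f k) + sum (λ j → δ k' j * f k')
    ≡⟨ cong₂ _+_ (sum-δˡ k (λ _ → f k)) (sum-δˡ k' (λ _ → f k')) ⟩
  f k + f k'                                 ∎
  where
  open ≡-Reasoning
  f≗ : ∀ j → f j ≡ δ k j * f k + δ k' j * f k'
  f≗ j with j Fin.≟ k | j Fin.≟ k'
  ... | yes refl | yes refl = ⊥-elim (k≢k' refl)
  ... | yes refl | no j≢k'  = sym (trans (cong₂ _+_ (δ*-refl j (f j)) (δ*-≢ (f k') (j≢k' ∘ sym))) (ℤP.+-identityʳ (f j)))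
  ... | no j≢k   | yes refl = sym (trans (cong₂ _+_ (δ*-≢ (f k) (j≢k ∘ sym)) (δ*-refl j (f j))) (ℤP.+-identityˡ (f j)))
  ... | no j≢k   | no j≢k'  = trans (vanish j j≢k j≢k')
                                    (sym (cong₂ _+_ (δ*-≢ (f k) (j≢k ∘ sym)) (δ*-≢ (f k') (j≢k' ∘ sym))))

sum-involution : ∀ {n} (τ : Fin n → Fin n) → (∀ a → τ (τ a) ≡ a) → (f : Fin n → ℤ) → sum f ≡ sum (f ∘ τ)
sum-involution τ τ-invol f = ∑-permute f (Perm.permutation τ τ τ-invol τ-invol)

sum-involution-parity : ∀ {n} (τ : Fin n → Fin n) → (∀ a → τ (τ a) ≡ a) →
                        (f : Fin n → ℤ) → (∀ a → f (τ a) ≡ f a) →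
                        ∃ λ L → sum f ≡ sum (λ a → f a * δ (τ a) a) + + 2 * L
sum-involution-parity {n} τ τ-invol f f∘τ≗f = sum (λ a → f a * below a) , (begin
  sum f                                                            ≡⟨ sum-cong-≗ split ⟩
  sum (λ a → f a * δ (τ a) a + f a * below a + f a * above a)
    ≡⟨ ∑-distrib-+ (λ a → f a * δ (τ a) a + f a * below a) (λ a → f a * above a) ⟩
  sum (λ a → f a * δ (τ a) a + f a * below a) + sum (λ a → f a * above a)
    ≡⟨ cong₂ _+_ (∑-distrib-+ (λ a → f a * δ (τ a) a) (λ a → f a * below a)) above≡below ⟩
  sum (λ a → f a * δ (τ a) a) + sum (λ a → f a * below a) + sum (λ a → f a * below a)
    ≡⟨ double (sum (λ a → f a * δ (τ a) a)) (sum (λ a → f a * below a)) ⟩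
  sum (λ a → f a * δ (τ a) a) + + 2 * sum (λ a → f a * below a)   ∎)
  where
  open ≡-Reasoning
  below above : Fin n → ℤ
  below a = boolToℤ (toℕ a ℕ.<ᵇ toℕ (τ a))
  above a = boolToℤ (toℕ (τ a) ℕ.<ᵇ toℕ a)
  double : ∀ x y → x + y + y ≡ x + + 2 * y
  double = solve-∀
  trichotomy : ∀ a → δ (τ a) a + below a + above a ≡ + 1
  trichotomy a with toℕ a ℕ.<ᵇ toℕ (τ a) | ℕP.<ᵇ-reflects-< (toℕ a) (toℕ (τ a))
                  | toℕ (τ a) ℕ.<ᵇ toℕ a | ℕP.<ᵇ-reflects-< (toℕ (τ a)) (toℕ a)
  ... | true  | ofʸ a<τa  | true  | ofʸ τa<a  = ⊥-elim (ℕP.<-asym a<τa τa<a)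
  ... | true  | ofʸ a<τa  | false | _         =
    cong (λ d → d + + 1 + + 0) (δ-≢ (λ τa≡a → ℕP.<-irrefl (cong toℕ (sym τa≡a)) a<τa))
  ... | false | _         | true  | ofʸ τa<a  =
    cong (λ d → d + + 0 + + 1) (δ-≢ (λ τa≡a → ℕP.<-irrefl (cong toℕ τa≡a) τa<a))
  ... | false | ofⁿ a≮τa  | false | ofⁿ τa≮a  = cong (λ d → d + + 0 + + 0)
    (trans (cong (λ b → δ b a) (FinP.toℕ-injective (ℕP.≤-antisym (ℕP.≮⇒≥ a≮τa) (ℕP.≮⇒≥ τa≮a)))) (δ-refl a))
  split : ∀ a → f a ≡ f a * δ (τ a) a + f a * below a + f a * above a
  split a = begin
    f a                                                  ≡⟨ ℤP.*-identityʳ (f a) ⟨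
    f a * + 1                                            ≡⟨ cong (f a *_) (trichotomy a) ⟨
    f a * (δ (τ a) a + below a + above a)                ≡⟨ distrib (f a) (δ (τ a) a) (below a) (above a) ⟩
    f a * δ (τ a) a + f a * below a + f a * above a      ∎
    where
    distrib : ∀ x d b c → x * (d + b + c) ≡ x * d + x * b + x * c
    distrib = solve-∀
  above≡below : sum (λ a → f a * above a) ≡ sum (λ a → f a * below a)
  above≡below = trans (sum-involution τ τ-invol (λ a → f a * above a))
    (sum-cong-≗ (λ a → cong₂ (λ x b → x * boolToℤ (toℕ b ℕ.<ᵇ toℕ (τ a))) (f∘τ≗f a) (τ-invol a)))

-- The Laplace determinant and its columns

Mat : ℕ → ℕ → Set
Mat m n = Fin m → Fin n → ℤ

infix 4 _≐_
_≐_ : Mat m n → Mat m n → Set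
A ≐ B = ∀ i j → A i j ≡ B i j

minor : Fin (suc n) → Matrix (suc n) → Matrix n
minor j M r c = M (suc r) (punchIn j c)

laplaceTerm : Matrix (suc n) → Fin (suc n) → ℤ
laplaceTerm {n} M j = sign (toℕ j) * M zero j * det n (minor j M)

det-expand : ∀ n (M : Matrix (suc n)) → det (suc n) M ≡ sum (laplaceTerm M)
det-expand n M = trans (cong (List.foldr _+_ (+ 0)) (ListP.map-tabulate (λ j → j) (laplaceTerm M)))
                       (foldr-tabulate (laplaceTerm M))

det-cong : ∀ n {A B : Matrix n} → A ≐ B → det n A ≡ det n B
det-cong zero    A≐B = refl
det-cong (suc n) {A} {B} A≐B = begin
  det (suc n) A          ≡⟨ det-expand n A ⟩
  sum (laplaceTerm A)    ≡⟨ sum-cong-≗ term≗ ⟩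
  sum (laplaceTerm B)    ≡⟨ det-expand n B ⟨
  det (suc n) B          ∎
  where
  open ≡-Reasoning
  term≗ : ∀ j → laplaceTerm A j ≡ laplaceTerm B j
  term≗ j = cong₂ (λ x y → sign (toℕ j) * x * y) (A≐B zero j)
                  (det-cong n (λ r c → A≐B (suc r) (punchIn j c)))

det-linear-column : ∀ n {A B C : Matrix n} (k : Fin n) (a b : ℤ) →
                    (∀ r c → c ≢ k → A r c ≡ C r c) → (∀ r c → c ≢ k → B r c ≡ C r c) →
                    (∀ r → C r k ≡ a * A r k + b * B r k) → det n C ≡ a * det n A + b * det n B
det-linear-column (suc n) {A} {B} {C} k a b A≈C B≈C Cₖ = begin
  det (suc n) C                                          ≡⟨ det-expand n C ⟩
  sum (laplaceTerm C)                                    ≡⟨ sum-cong-≗ term-linear ⟩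
  sum (λ j → a * laplaceTerm A j + b * laplaceTerm B j)  ≡⟨ sum-linear a b (laplaceTerm A) (laplaceTerm B) ⟩
  a * sum (laplaceTerm A) + b * sum (laplaceTerm B)
    ≡⟨ cong₂ (λ x y → a * x + b * y) (det-expand n A) (det-expand n B) ⟨
  a * det (suc n) A + b * det (suc n) B                  ∎
  where
  open ≡-Reasoning
  term-linear : ∀ j → laplaceTerm C j ≡ a * laplaceTerm A j + b * laplaceTerm B j
  term-linear j with j Fin.≟ k
  ... | yes refl = begin
    s * C zero j * det n (minor j C)
      ≡⟨ cong₂ (λ x y → s * x * y) (sym (Cₖ zero)) (det-cong n minorA≐minorC) ⟨
    s * (a * A zero j + b * B zero j) * det n (minor j A)
      ≡⟨ distrib a b s (A zero j) (B zero j) (det n (minor j A)) ⟩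
    a * laplaceTerm A j + b * (s * B zero j * det n (minor j A))
      ≡⟨ cong (λ y → a * laplaceTerm A j + b * (s * B zero j * y)) (det-cong n minorA≐minorB) ⟩
    a * laplaceTerm A j + b * laplaceTerm B j        ∎
    where
    s = sign (toℕ j)
    distrib : ∀ a b s x y d → s * (a * x + b * y) * d ≡ a * (s * x * d) + b * (s * y * d)
    distrib = solve-∀
    minorA≐minorC : minor j A ≐ minor j C
    minorA≐minorC r c = A≈C (suc r) (punchIn j c) (FinP.punchInᵢ≢i j c)
    minorA≐minorB : minor j A ≐ minor j B
    minorA≐minorB r c = trans (minorA≐minorC r c) (sym (B≈C (suc r) (punchIn j c) (FinP.punchInᵢ≢i j c)))
  ... | no j≢k = begin
    s * C zero j * det n (minor j C)                   ≡⟨ cong (s * C zero j *_) minor-linear ⟩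
    s * C zero j * (a * det n (minor j A) + b * det n (minor j B))
      ≡⟨ distrib a b s (C zero j) (det n (minor j A)) (det n (minor j B)) ⟩
    a * (s * C zero j * det n (minor j A)) + b * (s * C zero j * det n (minor j B))
      ≡⟨ cong₂ (λ x y → a * (s * x * det n (minor j A)) + b * (s * y * det n (minor j B)))
               (A≈C zero j j≢k) (B≈C zero j j≢k) ⟨
    a * laplaceTerm A j + b * laplaceTerm B j          ∎
    where
    s = sign (toℕ j)
    distrib : ∀ a b s x u v → s * x * (a * u + b * v) ≡ a * (s * x * u) + b * (s * x * v)
    distrib = solve-∀
    punchIn≢k : ∀ c → c ≢ punchOut j≢k → punchIn j c ≢ k
    punchIn≢k c c≢ eq = c≢ (FinP.punchIn-injective j c (punchOut j≢k) (trans eq (sym (FinP.punchIn-punchOut j≢k))))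
    minor-linear : det n (minor j C) ≡ a * det n (minor j A) + b * det n (minor j B)
    minor-linear = det-linear-column n (punchOut j≢k) a b
      (λ r c c≢ → A≈C (suc r) (punchIn j c) (punchIn≢k c c≢))
      (λ r c c≢ → B≈C (suc r) (punchIn j c) (punchIn≢k c c≢))
      (λ r → subst (λ c → C (suc r) c ≡ a * A (suc r) c + b * B (suc r) c)
                   (sym (FinP.punchIn-punchOut j≢k)) (Cₖ (suc r)))

toℕ-punchIn-< : (j : Fin (suc n)) (c : Fin n) → toℕ c ℕ.< toℕ j → toℕ (punchIn j c) ≡ toℕ c
toℕ-punchIn-< (suc j) zero    _          = refl
toℕ-punchIn-< (suc j) (suc c) (ℕ.s≤s c<j) = cong suc (toℕ-punchIn-< j c c<j)

toℕ-punchIn-≥ : (j : Fin (suc n)) (c : Fin n) → toℕ j ℕ.≤ toℕ c → toℕ (punchIn j c) ≡ suc (toℕ c)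
toℕ-punchIn-≥ zero    c       _           = refl
toℕ-punchIn-≥ (suc j) (suc c) (ℕ.s≤s j≤c) = cong suc (toℕ-punchIn-≥ j c j≤c)

Adjacent : Fin n → Fin n → Set
Adjacent k k' = toℕ k' ≡ suc (toℕ k)

adjacent⇒< : {k k' : Fin n} → Adjacent k k' → toℕ k ℕ.< toℕ k'
adjacent⇒< {k = k} adj = subst (toℕ k ℕ.<_) (sym adj) (ℕP.n<1+n (toℕ k))

punchIn-adjacent⁻¹ : (j : Fin (suc n)) {c c' : Fin n} → Adjacent (punchIn j c) (punchIn j c') → Adjacent c c'
punchIn-adjacent⁻¹ j {c} {c'} adj with toℕ c ℕ.<? toℕ j | toℕ c' ℕ.<? toℕ j
... | yes c<j | yes c'<j = trans (sym (toℕ-punchIn-< j c' c'<j)) (trans adj (cong suc (toℕ-punchIn-< j c c<j)))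
... | no c≮j  | no c'≮j  = ℕP.suc-injective
  (trans (sym (toℕ-punchIn-≥ j c' (ℕP.≮⇒≥ c'≮j))) (trans adj (cong suc (toℕ-punchIn-≥ j c (ℕP.≮⇒≥ c≮j)))))
... | yes c<j | no c'≮j  = ⊥-elim (ℕP.<⇒≱ c<j (subst (toℕ j ℕ.≤_) c'≡c (ℕP.≮⇒≥ c'≮j)))
  where
  c'≡c : toℕ c' ≡ toℕ c
  c'≡c = ℕP.suc-injective
    (trans (sym (toℕ-punchIn-≥ j c' (ℕP.≮⇒≥ c'≮j))) (trans adj (cong suc (toℕ-punchIn-< j c c<j))))
... | no c≮j  | yes c'<j = ⊥-elim (ℕP.<-asym c'<j (ℕP.≤-<-trans (ℕP.≮⇒≥ c≮j) c<c'))
  where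
  c<c' : toℕ c ℕ.< toℕ c'
  c<c' = subst (toℕ c ℕ.<_)
    (sym (trans (sym (toℕ-punchIn-< j c' c'<j)) (trans adj (cong suc (toℕ-punchIn-≥ j c (ℕP.≮⇒≥ c≮j))))))
    (ℕP.m<n⇒m<1+n (ℕP.n<1+n (toℕ c)))

minor-adjacent : {k k' : Fin (suc n)} (A : Matrix (suc n)) → Adjacent k k' →
                 (∀ r → A r k ≡ A r k') → minor k' A ≐ minor k A
minor-adjacent {k = k} {k'} A adj Aₖ≗Aₖ' r c with ℕP.<-cmp (toℕ c) (toℕ k)
... | tri< c<k _ _ = cong (A (suc r)) (FinP.toℕ-injective
  (trans (toℕ-punchIn-< k' c (ℕP.<-trans c<k (adjacent⇒< adj))) (sym (toℕ-punchIn-< k c c<k))))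
... | tri≈ _ c≡k _ = begin
  A (suc r) (punchIn k' c)   ≡⟨ cong (A (suc r)) (FinP.toℕ-injective
                                 (trans (toℕ-punchIn-< k' c (subst (ℕ._< toℕ k') (sym c≡k) (adjacent⇒< adj))) c≡k)) ⟩
  A (suc r) k                ≡⟨ Aₖ≗Aₖ' (suc r) ⟩
  A (suc r) k'               ≡⟨ cong (A (suc r)) (FinP.toℕ-injective
                                 (trans adj (sym (trans (toℕ-punchIn-≥ k c (ℕP.≤-reflexive (sym c≡k))) (cong suc c≡k))))) ⟩
  A (suc r) (punchIn k c)    ∎
  where open ≡-Reasoning
... | tri> _ _ k<c = cong (A (suc r)) (FinP.toℕ-injective
  (trans (toℕ-punchIn-≥ k' c (subst (ℕ._≤ toℕ c) (sym adj) k<c)) (sym (toℕ-punchIn-≥ k c (ℕP.<⇒≤ k<c)))))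

det-equalAdjacentColumns : ∀ n (A : Matrix n) {k k' : Fin n} → Adjacent k k' →
                           (∀ r → A r k ≡ A r k') → det n A ≡ + 0
det-equalAdjacentColumns (suc n) A {k} {k'} adj Aₖ≗Aₖ' = begin
  det (suc n) A                        ≡⟨ det-expand n A ⟩
  sum (laplaceTerm A)                  ≡⟨ sum-pair (laplaceTerm A) k≢k' vanish ⟩
  laplaceTerm A k + laplaceTerm A k'
    ≡⟨ cong₂ (λ σ y → laplaceTerm A k + σ * y * det n (minor k' A)) (cong sign adj) (sym (Aₖ≗Aₖ' zero)) ⟩
  s * x * d + (- s) * x * det n (minor k' A)
    ≡⟨ cong (λ d' → s * x * d + (- s) * x * d') (det-cong n (minor-adjacent A adj Aₖ≗Aₖ')) ⟩
  s * x * d + (- s) * x * d            ≡⟨ cancel s x d ⟩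
  + 0                                  ∎
  where
  open ≡-Reasoning
  s = sign (toℕ k)
  x = A zero k
  d = det n (minor k A)
  cancel : ∀ s x d → s * x * d + (- s) * x * d ≡ + 0
  cancel = solve-∀
  k≢k' : k ≢ k'
  k≢k' refl = ℕP.1+n≢n (sym adj)
  vanish : ∀ j → j ≢ k → j ≢ k' → laplaceTerm A j ≡ + 0
  vanish j j≢k j≢k' = trans (cong (sign (toℕ j) * A zero j *_) minor-vanishes) (ℤP.*-zeroʳ (sign (toℕ j) * A zero j))
    where
    minor-vanishes : det n (minor j A) ≡ + 0
    minor-vanishes = det-equalAdjacentColumns n (minor j A)
      (punchIn-adjacent⁻¹ j (subst₂ Adjacent (sym (FinP.punchIn-punchOut j≢k)) (sym (FinP.punchIn-punchOut j≢k')) adj))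
      (λ r → subst₂ (λ c c' → A (suc r) c ≡ A (suc r) c')
                    (sym (FinP.punchIn-punchOut j≢k)) (sym (FinP.punchIn-punchOut j≢k')) (Aₖ≗Aₖ' (suc r)))


-- Alternating multilinear forms

1ᴹ : Matrix n
1ᴹ = δ

_[_]≔_ : Matrix n → Fin n → (Fin n → ℤ) → Matrix n
A [ i ]≔ v = updateAt A i (λ _ → v)

[]≔-updates : (A : Matrix n) (i : Fin n) (v : Fin n → ℤ) → (A [ i ]≔ v) i ≡ v
[]≔-updates A i v = updateAt-updates i A

[]≔-minimal : (A : Matrix n) {i r : Fin n} (v : Fin n → ℤ) → r ≢ i → (A [ i ]≔ v) r ≡ A r
[]≔-minimal A {i} {r} v r≢i = updateAt-minimal r i A r≢i

record IsMultilinear (f : Matrix n → ℤ) : Set where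
  field
    resp-≐ : {A B : Matrix n} → A ≐ B → f A ≡ f B
    linear : ∀ (A B C : Matrix n) (i : Fin n) (a b : ℤ) →
             (∀ r c → r ≢ i → A r c ≡ C r c) → (∀ r c → r ≢ i → B r c ≡ C r c) →
             (∀ c → C i c ≡ a * A i c + b * B i c) → f C ≡ a * f A + b * f B

record IsAlternating (f : Matrix n → ℤ) : Set where
  field
    isMultilinear : IsMultilinear f
    alternating   : ∀ A {i k} → i ≢ k → (∀ c → A i c ≡ A k c) → f A ≡ + 0
  open IsMultilinear isMultilinear public

module MultilinearProperties {f : Matrix n → ℤ} (ml : IsMultilinear f) where
  open IsMultilinear ml

  additive : ∀ {A B C} i →
             (∀ r c → r ≢ i → A r c ≡ C r c) → (∀ r c → r ≢ i → B r c ≡ C r c) →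
             (∀ c → C i c ≡ A i c + B i c) → f C ≡ f A + f B
  additive {A} {B} {C} i A≈C B≈C Cᵢ =
    trans (linear A B C i (+ 1) (+ 1) A≈C B≈C
                  (λ c → trans (Cᵢ c) (sym (cong₂ _+_ (ℤP.*-identityˡ (A i c)) (ℤP.*-identityˡ (B i c))))))
          (cong₂ _+_ (ℤP.*-identityˡ (f A)) (ℤP.*-identityˡ (f B)))

  zeroRow : ∀ A i → (∀ c → A i c ≡ + 0) → f A ≡ + 0
  zeroRow A i Aᵢ≗0 =
    trans (linear A A A i (+ 0) (+ 0) (λ _ _ _ → refl) (λ _ _ _ → refl)
                  (λ c → trans (Aᵢ≗0 c) (sym (cong₂ _+_ (ℤP.*-zeroˡ (A i c)) (ℤP.*-zeroˡ (A i c))))))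
          (cong₂ _+_ (ℤP.*-zeroˡ (f A)) (ℤP.*-zeroˡ (f A)))

  linear-[]≔ : ∀ A i a b (u w : Fin n → ℤ) →
               f (A [ i ]≔ (λ c → a * u c + b * w c)) ≡ a * f (A [ i ]≔ u) + b * f (A [ i ]≔ w)
  linear-[]≔ A i a b u w = linear (A [ i ]≔ u) (A [ i ]≔ w) (A [ i ]≔ v) i a b
    (λ r c r≢i → trans (cong-app ([]≔-minimal A u r≢i) c) (sym (cong-app ([]≔-minimal A v r≢i) c)))
    (λ r c r≢i → trans (cong-app ([]≔-minimal A w r≢i) c) (sym (cong-app ([]≔-minimal A v r≢i) c)))
    (λ c → trans (cong-app ([]≔-updates A i v) c)
                 (sym (cong₂ (λ x y → a * x + b * y) (cong-app ([]≔-updates A i u) c) (cong-app ([]≔-updates A i w) c))))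
    where
    v = λ c → a * u c + b * w c

  []≔-resp : ∀ A i {u w : Fin n → ℤ} → (∀ c → u c ≡ w c) → f (A [ i ]≔ u) ≡ f (A [ i ]≔ w)
  []≔-resp A i {u} {w} u≗w = resp-≐ λ r c → entry r c
    where
    entry : ∀ r c → (A [ i ]≔ u) r c ≡ (A [ i ]≔ w) r c
    entry r c with r Fin.≟ i
    ... | yes refl = trans (cong-app ([]≔-updates A r u) c) (trans (u≗w c) (sym (cong-app ([]≔-updates A r w) c)))
    ... | no r≢i   = trans (cong-app ([]≔-minimal A u r≢i) c) (sym (cong-app ([]≔-minimal A w r≢i) c))

  linear-sum : ∀ A i (cs : Fin m → ℤ) (vs : Fin m → Fin n → ℤ) →
               f (A [ i ]≔ (λ c → sum (λ j → cs j * vs j c))) ≡ sum (λ j → cs j * f (A [ i ]≔ vs j))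
  linear-sum {zero}  A i cs vs = zeroRow (A [ i ]≔ (λ _ → + 0)) i (λ c → cong-app ([]≔-updates A i _) c)
  linear-sum {suc m} A i cs vs = begin
    f (A [ i ]≔ (λ c → cs zero * vs zero c + rest c))
      ≡⟨ []≔-resp A i (λ c → cong (_+_ (cs zero * vs zero c)) (sym (ℤP.*-identityˡ (rest c)))) ⟩
    f (A [ i ]≔ (λ c → cs zero * vs zero c + + 1 * rest c))
      ≡⟨ linear-[]≔ A i (cs zero) (+ 1) (vs zero) rest ⟩
    cs zero * f (A [ i ]≔ vs zero) + + 1 * f (A [ i ]≔ rest)
      ≡⟨ cong (_+_ (cs zero * f (A [ i ]≔ vs zero)))
              (trans (ℤP.*-identityˡ _) (linear-sum A i (cs ∘ suc) (vs ∘ suc))) ⟩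
    sum (λ j → cs j * f (A [ i ]≔ vs j))  ∎
    where
    open ≡-Reasoning
    rest : Fin n → ℤ
    rest c = sum (λ j → cs (suc j) * vs (suc j) c)

  swapRows : Matrix n → Fin n → Fin n → Matrix n
  swapRows A i k = (A [ i ]≔ A k) [ k ]≔ A i

  swapRows-antisym : ∀ A {i k} → i ≢ k → (∀ B → (∀ c → B i c ≡ B k c) → f B ≡ + 0) →
                     f (swapRows A i k) ≡ - f A
  swapRows-antisym A {i} {k} i≢k vanish = begin
    f (P v u)     ≡⟨ inverseʳ-unique (f (P u v)) (f (P v u)) sum≡0 ⟩
    - f (P u v)   ≡⟨ cong -_ (resp-≐ P-id) ⟩
    - f A         ∎
    where
    open ≡-Reasoning
    u = A i
    v = A k
    u+v : Fin n → ℤ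
    u+v c = u c + v c
    P : (Fin n → ℤ) → (Fin n → ℤ) → Matrix n
    P x y = (A [ i ]≔ x) [ k ]≔ y
    P-i : ∀ x y → P x y i ≡ x
    P-i x y = trans ([]≔-minimal (A [ i ]≔ x) y i≢k) ([]≔-updates A i x)
    P-k : ∀ x y → P x y k ≡ y
    P-k x y = []≔-updates (A [ i ]≔ x) k y
    P-offᵢ : ∀ x x' y r c → r ≢ i → P x y r c ≡ P x' y r c
    P-offᵢ x x' y r c r≢i with r Fin.≟ k
    ... | yes refl = cong-app (trans (P-k x y) (sym (P-k x' y))) c
    ... | no r≢k   = cong-app (trans ([]≔-minimal _ y r≢k) (trans ([]≔-minimal A x r≢i)
                               (sym (trans ([]≔-minimal _ y r≢k) ([]≔-minimal A x' r≢i))))) c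
    P-offₖ : ∀ x y y' r c → r ≢ k → P x y r c ≡ P x y' r c
    P-offₖ x y y' r c r≢k = cong-app (trans ([]≔-minimal _ y r≢k) (sym ([]≔-minimal _ y' r≢k))) c
    P-id : P u v ≐ A
    P-id r c with r Fin.≟ k | r Fin.≟ i
    ... | yes refl | _        = cong-app (P-k u v) c
    ... | no r≢k   | yes refl = cong-app (P-i u v) c
    ... | no r≢k   | no r≢i   = cong-app (trans ([]≔-minimal _ v r≢k) ([]≔-minimal A u r≢i)) c
    diagonal : ∀ x → f (P x x) ≡ + 0
    diagonal x = vanish (P x x) (λ c → cong-app (trans (P-i x x) (sym (P-k x x))) c)
    splitₖ : ∀ x → f (P x u+v) ≡ f (P x u) + f (P x v)
    splitₖ x = additive k (P-offₖ x u u+v) (P-offₖ x v u+v)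
      (λ c → trans (cong-app (P-k x u+v) c) (sym (cong₂ _+_ (cong-app (P-k x u) c) (cong-app (P-k x v) c))))
    sum≡0 : f (P u v) + f (P v u) ≡ + 0
    sum≡0 = begin
      f (P u v) + f (P v u)
        ≡⟨ cong₂ _+_ (sym (ℤP.+-identityˡ (f (P u v)))) (sym (ℤP.+-identityʳ (f (P v u)))) ⟩
      (+ 0 + f (P u v)) + (f (P v u) + + 0)
        ≡⟨ cong₂ (λ x y → (x + f (P u v)) + (f (P v u) + y)) (sym (diagonal u)) (sym (diagonal v)) ⟩
      (f (P u u) + f (P u v)) + (f (P v u) + f (P v v))  ≡⟨ cong₂ _+_ (splitₖ u) (splitₖ v) ⟨
      f (P u u+v) + f (P v u+v)                          ≡⟨ additive i (P-offᵢ u u+v u+v) (P-offᵢ v u+v u+v)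
                                                              (λ c → trans (cong-app (P-i u+v u+v) c)
                                                                (sym (cong₂ _+_ (cong-app (P-i u u+v) c) (cong-app (P-i v u+v) c)))) ⟨
      f (P u+v u+v)                                      ≡⟨ diagonal u+v ⟩
      + 0                                                ∎

  private
    atDistance : (∀ A {i k} → Adjacent i k → (∀ c → A i c ≡ A k c) → f A ≡ + 0) →
                 ∀ d A {i k} → toℕ k ≡ suc (d ℕ.+ toℕ i) → (∀ c → A i c ≡ A k c) → f A ≡ + 0
    atDistance adj zero    A eq Aᵢ≗Aₖ = adj A eq Aᵢ≗Aₖ
    atDistance adj (suc d) A {i} {k} eq Aᵢ≗Aₖ = begin
      f A                      ≡⟨ ℤP.neg-involutive (f A) ⟨
      - - f A                  ≡⟨ cong -_ (swapRows-antisym A k'≢k (λ B → adj B k'-adj-k)) ⟨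
      - f (swapRows A k' k)    ≡⟨ cong -_ (atDistance adj d (swapRows A k' k) toℕ-k' swapped-equal) ⟩
      + 0                      ∎
      where
      open ≡-Reasoning
      k'<n : suc (d ℕ.+ toℕ i) ℕ.< n
      k'<n = ℕP.<-trans (subst (suc (d ℕ.+ toℕ i) ℕ.<_) (sym eq) (ℕP.n<1+n _)) (FinP.toℕ<n k)
      k' = Fin.fromℕ< k'<n
      toℕ-k' : toℕ k' ≡ suc (d ℕ.+ toℕ i)
      toℕ-k' = FinP.toℕ-fromℕ< k'<n
      k'-adj-k : Adjacent k' k
      k'-adj-k = trans eq (cong suc (sym toℕ-k'))
      k'≢k : k' ≢ k
      k'≢k k'≡k = ℕP.1+n≢n (sym (trans k'-adj-k (cong (suc ∘ toℕ) k'≡k)))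
      i≢k' : i ≢ k'
      i≢k' i≡k' = ℕP.<-irrefl (trans (cong toℕ i≡k') toℕ-k') (ℕ.s≤s (ℕP.m≤n+m (toℕ i) d))
      i≢k : i ≢ k
      i≢k i≡k = ℕP.<-irrefl (trans (cong toℕ i≡k) eq) (ℕ.s≤s (ℕP.m≤n+m (toℕ i) (suc d)))
      swapped-equal : ∀ c → swapRows A k' k i c ≡ swapRows A k' k k' c
      swapped-equal c = trans (cong-app (trans ([]≔-minimal _ (A k') i≢k) ([]≔-minimal A (A k) i≢k')) c)
                       (trans (Aᵢ≗Aₖ c)
                       (sym (cong-app (trans ([]≔-minimal _ (A k') k'≢k) ([]≔-updates A k' (A k))) c)))

  alternating-fromAdjacent : (∀ A {i k} → Adjacent i k → (∀ c → A i c ≡ A k c) → f A ≡ + 0) →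
                             ∀ A {i k} → i ≢ k → (∀ c → A i c ≡ A k c) → f A ≡ + 0
  alternating-fromAdjacent adj A {i} {k} i≢k Aᵢ≗Aₖ with ℕP.<-cmp (toℕ i) (toℕ k)
  ... | tri< i<k _ _ = atDistance adj (toℕ k ℕ.∸ suc (toℕ i)) A
                         (sym (trans (sym (ℕP.+-suc _ (toℕ i))) (ℕP.m∸n+n≡m i<k))) Aᵢ≗Aₖ
  ... | tri≈ _ i≡k _ = ⊥-elim (i≢k (FinP.toℕ-injective i≡k))
  ... | tri> _ _ k<i = atDistance adj (toℕ i ℕ.∸ suc (toℕ k)) A
                         (sym (trans (sym (ℕP.+-suc _ (toℕ k))) (ℕP.m∸n+n≡m k<i))) (λ c → sym (Aᵢ≗Aₖ c))

module AlternatingProperties {f : Matrix n → ℤ} (alt : IsAlternating f) where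
  open IsAlternating alt
  open MultilinearProperties isMultilinear public

  rowAdd-invariant : ∀ A {i k} → i ≢ k → ∀ t → f (A [ i ]≔ (λ c → A i c + t * A k c)) ≡ f A
  rowAdd-invariant A {i} {k} i≢k t = begin
    f (A [ i ]≔ (λ c → A i c + t * A k c))
      ≡⟨ []≔-resp A i (λ c → cong (_+ t * A k c) (sym (ℤP.*-identityˡ (A i c)))) ⟩
    f (A [ i ]≔ (λ c → + 1 * A i c + t * A k c))    ≡⟨ linear-[]≔ A i (+ 1) t (A i) (A k) ⟩
    + 1 * f (A [ i ]≔ A i) + t * f (A [ i ]≔ A k)
      ≡⟨ cong₂ (λ x y → + 1 * x + t * y) (resp-≐ unchanged) repeated ⟩
    + 1 * f A + t * + 0                              ≡⟨ simplify (f A) t ⟩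
    f A                                              ∎
    where
    open ≡-Reasoning
    simplify : ∀ x t → + 1 * x + t * + 0 ≡ x
    simplify = solve-∀
    unchanged : A [ i ]≔ A i ≐ A
    unchanged r c with r Fin.≟ i
    ... | yes refl = cong-app ([]≔-updates A r (A r)) c
    ... | no r≢i   = cong-app ([]≔-minimal A (A i) r≢i) c
    repeated : f (A [ i ]≔ A k) ≡ + 0
    repeated = alternating (A [ i ]≔ A k) i≢k
      (λ c → cong-app (trans ([]≔-updates A i (A k)) (sym ([]≔-minimal A (A k) (i≢k ∘ sym)))) c)

punchIn-cover : (j c : Fin (suc m)) → c ≡ j ⊎ ∃ λ c₀ → punchIn j c₀ ≡ c
punchIn-cover j c with j Fin.≟ c
... | yes j≡c = inj₁ (sym j≡c)
... | no j≢c  = inj₂ (punchOut j≢c , FinP.punchIn-punchOut j≢c)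

insertAt-cong : {u w : Fin m → ℤ} → (∀ c → u c ≡ w c) → ∀ j c → insertAt u j (+ 0) c ≡ insertAt w j (+ 0) c
insertAt-cong {u = u} {w} u≗w j c with punchIn-cover j c
... | inj₁ refl         = trans (insertAt-lookup u j (+ 0)) (sym (insertAt-lookup w j (+ 0)))
... | inj₂ (c₀ , refl)  = trans (insertAt-punchIn u j (+ 0) c₀) (trans (u≗w c₀) (sym (insertAt-punchIn w j (+ 0) c₀)))

insertAt-linear : ∀ a b (u w : Fin m → ℤ) j c →
                  insertAt (λ c → a * u c + b * w c) j (+ 0) c ≡ a * insertAt u j (+ 0) c + b * insertAt w j (+ 0) c
insertAt-linear a b u w j c with punchIn-cover j c
... | inj₁ refl = begin
  insertAt _ c (+ 0) c                                   ≡⟨ insertAt-lookup _ c (+ 0) ⟩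
  + 0                                                    ≡⟨ cong₂ _+_ (ℤP.*-zeroʳ a) (ℤP.*-zeroʳ b) ⟨
  a * + 0 + b * + 0
    ≡⟨ cong₂ (λ x y → a * x + b * y) (insertAt-lookup u c (+ 0)) (insertAt-lookup w c (+ 0)) ⟨
  a * insertAt u c (+ 0) c + b * insertAt w c (+ 0) c    ∎
  where open ≡-Reasoning
... | inj₂ (c₀ , refl) = trans (insertAt-punchIn _ j (+ 0) c₀)
  (sym (cong₂ (λ x y → a * x + b * y) (insertAt-punchIn u j (+ 0) c₀) (insertAt-punchIn w j (+ 0) c₀)))

insertAt-zero : ∀ (j c : Fin (suc m)) → insertAt (λ _ → + 0) j (+ 0) c ≡ + 0
insertAt-zero j c with punchIn-cover j c
... | inj₁ refl        = insertAt-lookup _ j (+ 0)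
... | inj₂ (c₀ , refl) = insertAt-punchIn _ j (+ 0) c₀

insertAt-removeAt-0 : ∀ j (v : Fin (suc m) → ℤ) c → insertAt (v ∘ punchIn j) j (+ 0) c ≡ v c - v j * δ j c
insertAt-removeAt-0 j v c with punchIn-cover j c
... | inj₁ refl = begin
  insertAt (v ∘ punchIn c) c (+ 0) c   ≡⟨ insertAt-lookup _ c (+ 0) ⟩
  + 0                                  ≡⟨ ℤP.+-inverseʳ (v c) ⟨
  v c - v c                            ≡⟨ cong (λ x → v c - x) (ℤP.*-identityʳ (v c)) ⟨
  v c - v c * + 1                      ≡⟨ cong (λ x → v c - v c * x) (δ-refl c) ⟨
  v c - v c * δ c c                    ∎
  where open ≡-Reasoning
... | inj₂ (c₀ , refl) = begin
  insertAt (v ∘ punchIn j) j (+ 0) (punchIn j c₀)   ≡⟨ insertAt-punchIn _ j (+ 0) c₀ ⟩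
  v (punchIn j c₀)                                  ≡⟨ ℤP.+-identityʳ _ ⟨
  v (punchIn j c₀) - + 0                            ≡⟨ cong (λ x → v (punchIn j c₀) - x) (ℤP.*-zeroʳ (v j)) ⟨
  v (punchIn j c₀) - v j * + 0
    ≡⟨ cong (λ x → v (punchIn j c₀) - v j * x) (δ-≢ (FinP.punchInᵢ≢i j c₀ ∘ sym)) ⟨
  v (punchIn j c₀) - v j * δ j (punchIn j c₀)       ∎
  where open ≡-Reasoning

expandAt : Fin (suc m) → Matrix m → Matrix (suc m)
expandAt j B zero    = δ j
expandAt j B (suc r) = insertAt (B r) j (+ 0)

expandAt-isAlternating : {f : Matrix (suc m) → ℤ} → IsAlternating f → ∀ j → IsAlternating (f ∘ expandAt j)
expandAt-isAlternating {f = f} alt j = record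
  { isMultilinear = record { resp-≐ = resp-≐′ ; linear = linear′ }
  ; alternating   = alternating′
  }
  where
  open IsAlternating alt
  resp-≐′ : ∀ {A B} → A ≐ B → f (expandAt j A) ≡ f (expandAt j B)
  resp-≐′ A≐B = resp-≐ λ { zero c → refl ; (suc r) c → insertAt-cong (A≐B r) j c }
  linear′ : ∀ A B C i a b → (∀ r c → r ≢ i → A r c ≡ C r c) → (∀ r c → r ≢ i → B r c ≡ C r c) →
            (∀ c → C i c ≡ a * A i c + b * B i c) → f (expandAt j C) ≡ a * f (expandAt j A) + b * f (expandAt j B)
  linear′ A B C i a b A≈C B≈C Cᵢ = linear _ _ _ (suc i) a b
    (λ { zero c _ → refl ; (suc r) c r≢i → insertAt-cong (λ c′ → A≈C r c′ (r≢i ∘ cong suc)) j c })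
    (λ { zero c _ → refl ; (suc r) c r≢i → insertAt-cong (λ c′ → B≈C r c′ (r≢i ∘ cong suc)) j c })
    (λ c → trans (insertAt-cong Cᵢ j c) (insertAt-linear a b (A i) (B i) j c))
  alternating′ : ∀ A {i k} → i ≢ k → (∀ c → A i c ≡ A k c) → f (expandAt j A) ≡ + 0
  alternating′ A i≢k Aᵢ≗Aₖ = alternating _ (i≢k ∘ FinP.suc-injective) (insertAt-cong Aᵢ≗Aₖ j)

expandAt-1ᴹ : ∀ {m} {f : Matrix (suc m) → ℤ} → IsAlternating f → ∀ j → f (expandAt j 1ᴹ) ≡ sign (toℕ j) * f 1ᴹ
expandAt-1ᴹ alt zero = trans (IsAlternating.resp-≐ alt expandAt-0-1ᴹ) (sym (ℤP.*-identityˡ _))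
  where
  expandAt-0-1ᴹ : expandAt zero 1ᴹ ≐ 1ᴹ
  expandAt-0-1ᴹ zero    c       = refl
  expandAt-0-1ᴹ (suc r) zero    = refl
  expandAt-0-1ᴹ (suc r) (suc c) = refl
expandAt-1ᴹ {suc m} {f} alt (suc j) = begin
  f S                                      ≡⟨ ℤP.neg-involutive (f S) ⟨
  - - f S                                  ≡⟨ cong -_ (swapRows-antisym S 0≢1 (λ B → alternating B 0≢1)) ⟨
  - f (swapRows S zero (suc zero))         ≡⟨ cong -_ (resp-≐ swapped) ⟩
  - f (expandAt zero (expandAt j 1ᴹ))      ≡⟨ cong -_ (expandAt-1ᴹ (expandAt-isAlternating alt zero) j) ⟩
  - (sign (toℕ j) * f (expandAt zero 1ᴹ))  ≡⟨ cong (λ x → - (sign (toℕ j) * x)) (expandAt-1ᴹ alt zero) ⟩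
  - (sign (toℕ j) * (+ 1 * f 1ᴹ))          ≡⟨ cong (λ x → - (sign (toℕ j) * x)) (ℤP.*-identityˡ (f 1ᴹ)) ⟩
  - (sign (toℕ j) * f 1ᴹ)                  ≡⟨ ℤP.neg-distribˡ-* (sign (toℕ j)) (f 1ᴹ) ⟩
  sign (toℕ (suc j)) * f 1ᴹ                ∎
  where
  open ≡-Reasoning
  open IsAlternating alt
  open AlternatingProperties alt
  S = expandAt (suc j) 1ᴹ
  0≢1 : zero ≢ suc zero
  0≢1 ()
  swapped : swapRows S zero (suc zero) ≐ expandAt zero (expandAt j 1ᴹ)
  swapped zero          zero    = refl
  swapped zero          (suc c) = insertAt-zero j c
  swapped (suc zero)    zero    = refl
  swapped (suc zero)    (suc c) = refl
  swapped (suc (suc r)) zero    = refl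
  swapped (suc (suc r)) (suc c) = refl

sweep : Matrix (suc m) → (Fin m → ℤ) → Matrix (suc m)
sweep A t zero    = A zero
sweep A t (suc r) = λ c → A (suc r) c + t r * A zero c

module _ {f : Matrix (suc m) → ℤ} (alt : IsAlternating f) where
  open IsAlternating alt
  open AlternatingProperties alt

  private
    truncate : ℕ → (Fin m → ℤ) → Fin m → ℤ
    truncate s t r = if toℕ r ℕ.<ᵇ s then t r else + 0

    truncate-all : ∀ t r → truncate m t r ≡ t r
    truncate-all t r with toℕ r ℕ.<ᵇ m | ℕP.<ᵇ-reflects-< (toℕ r) m
    ... | true  | _         = refl
    ... | false | ofⁿ r≮m   = ⊥-elim (r≮m (FinP.toℕ<n r))

    truncate-new : ∀ {s} t (s<m : s ℕ.< m) → truncate (suc s) t (Fin.fromℕ< s<m) ≡ t (Fin.fromℕ< s<m)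
    truncate-new {s} t s<m with toℕ (Fin.fromℕ< s<m) ℕ.<ᵇ suc s | ℕP.<ᵇ-reflects-< (toℕ (Fin.fromℕ< s<m)) (suc s)
    ... | true  | _          = refl
    ... | false | ofⁿ r≮1+s  = ⊥-elim (r≮1+s (subst (ℕ._< suc s) (sym (FinP.toℕ-fromℕ< s<m)) (ℕP.n<1+n s)))

    truncate-old : ∀ {s} t (s<m : s ℕ.< m) → truncate s t (Fin.fromℕ< s<m) ≡ + 0
    truncate-old {s} t s<m with toℕ (Fin.fromℕ< s<m) ℕ.<ᵇ s | ℕP.<ᵇ-reflects-< (toℕ (Fin.fromℕ< s<m)) s
    ... | false | _        = refl
    ... | true  | ofʸ r<s  = ⊥-elim (ℕP.<-irrefl (FinP.toℕ-fromℕ< s<m) r<s)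

    truncate-step : ∀ {s} t {r} (s<m : s ℕ.< m) → r ≢ Fin.fromℕ< s<m → truncate (suc s) t r ≡ truncate s t r
    truncate-step {s} t {r} s<m r≢s
      with toℕ r ℕ.<ᵇ suc s | ℕP.<ᵇ-reflects-< (toℕ r) (suc s) | toℕ r ℕ.<ᵇ s | ℕP.<ᵇ-reflects-< (toℕ r) s
    ... | true  | _            | true  | _          = refl
    ... | false | _            | false | _          = refl
    ... | true  | ofʸ r<1+s    | false | ofⁿ r≮s    = ⊥-elim (r≢s (FinP.toℕ-injective
          (trans (ℕP.≤-antisym (ℕP.≤-pred r<1+s) (ℕP.≮⇒≥ r≮s)) (sym (FinP.toℕ-fromℕ< s<m)))))
    ... | false | ofⁿ r≮1+s    | true  | ofʸ r<s    = ⊥-elim (r≮1+s (ℕP.m<n⇒m<1+n r<s))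

    sweep-partial : ∀ A t s → s ℕ.≤ m → f (sweep A (truncate s t)) ≡ f A
    sweep-partial A t zero    _     = resp-≐ λ
      { zero    c → refl
      ; (suc r) c → trans (cong (_+_ (A (suc r) c)) (ℤP.*-zeroˡ (A zero c))) (ℤP.+-identityʳ _) }
    sweep-partial A t (suc s) s<m = begin
      f (sweep A (truncate (suc s) t))   ≡⟨ resp-≐ one-more-row ⟩
      f (X [ suc r₀ ]≔ (λ c → X (suc r₀) c + t r₀ * X zero c))
        ≡⟨ rowAdd-invariant X {suc r₀} {zero} (λ ()) (t r₀) ⟩
      f X                                ≡⟨ sweep-partial A t s (ℕP.<⇒≤ s<m) ⟩
      f A                                ∎
      where
      open ≡-Reasoning
      X = sweep A (truncate s t)
      r₀ = Fin.fromℕ< s<m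
      one-more-row : sweep A (truncate (suc s) t) ≐ X [ suc r₀ ]≔ (λ c → X (suc r₀) c + t r₀ * X zero c)
      one-more-row zero    c = refl
      one-more-row (suc r) c with r Fin.≟ r₀
      ... | yes refl = begin
        A (suc r) c + truncate (suc s) t r * A zero c
          ≡⟨ cong (λ x → A (suc r) c + x * A zero c) (truncate-new t s<m) ⟩
        A (suc r) c + t r * A zero c
          ≡⟨ cong (_+ t r * A zero c) (ℤP.+-identityʳ (A (suc r) c)) ⟨
        A (suc r) c + + 0 + t r * A zero c
          ≡⟨ cong (λ x → A (suc r) c + x + t r * A zero c) (ℤP.*-zeroˡ (A zero c)) ⟨
        A (suc r) c + + 0 * A zero c + t r * A zero c
          ≡⟨ cong (λ x → A (suc r) c + x * A zero c + t r * A zero c) (truncate-old t s<m) ⟨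
        X (suc r) c + t r * X zero c                           ≡⟨ cong-app ([]≔-updates X (suc r) _) c ⟨
        (X [ suc r ]≔ (λ c → X (suc r) c + t r * X zero c)) (suc r) c  ∎
      ... | no r≢r₀ = trans (cong (λ x → A (suc r) c + x * A zero c) (truncate-step t s<m r≢r₀))
                            (sym (cong-app ([]≔-minimal X _ (r≢r₀ ∘ FinP.suc-injective)) c))

  sweep-invariant : ∀ A t → f (sweep A t) ≡ f A
  sweep-invariant A t = trans (resp-≐ untruncate) (sweep-partial A t m ℕP.≤-refl)
    where
    untruncate : sweep A t ≐ sweep A (truncate m t)
    untruncate zero    c = refl
    untruncate (suc r) c = cong (λ x → A (suc r) c + x * A zero c) (sym (truncate-all t r))

  clearColumn : ∀ A j → f (A [ zero ]≔ δ j) ≡ f (expandAt j (minor j A))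
  clearColumn A j = trans (sym (sweep-invariant (A [ zero ]≔ δ j) (λ r → - A (suc r) j))) (resp-≐ cleared)
    where
    subtract : ∀ x a d → x + (- a) * d ≡ x - a * d
    subtract = solve-∀
    cleared : sweep (A [ zero ]≔ δ j) (λ r → - A (suc r) j) ≐ expandAt j (minor j A)
    cleared zero    c = refl
    cleared (suc r) c = trans (subtract (A (suc r) c) (A (suc r) j) (δ j c))
                              (sym (insertAt-removeAt-0 j (A (suc r)) c))


-- Uniqueness of alternating forms, transposes and products

alternating-unique : ∀ n {f : Matrix n → ℤ} → IsAlternating f → ∀ A → f A ≡ det n A * f 1ᴹ
alternating-unique zero    alt A = trans (IsAlternating.resp-≐ alt (λ ())) (sym (ℤP.*-identityˡ _))
alternating-unique (suc m) {f} alt A = begin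
  f A                                                  ≡⟨ resp-≐ firstRow-expanded ⟩
  f (A [ zero ]≔ (λ c → sum (λ j → A zero j * δ j c))) ≡⟨ linear-sum A zero (A zero) δ ⟩
  sum (λ j → A zero j * f (A [ zero ]≔ δ j))           ≡⟨ sum-cong-≗ term ⟩
  sum (λ j → laplaceTerm A j * f 1ᴹ)                   ≡⟨ *-distribʳ-sum (f 1ᴹ) (laplaceTerm A) ⟨
  sum (laplaceTerm A) * f 1ᴹ                           ≡⟨ cong (_* f 1ᴹ) (det-expand m A) ⟨
  det (suc m) A * f 1ᴹ                                 ∎
  where
  open ≡-Reasoning
  open IsAlternating alt
  open AlternatingProperties alt
  firstRow-expanded : A ≐ A [ zero ]≔ (λ c → sum (λ j → A zero j * δ j c))
  firstRow-expanded zero    c = sym (trans (sum-cong-≗ (λ j → ℤP.*-comm (A zero j) (δ j c))) (sum-δʳ c (A zero)))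
  firstRow-expanded (suc r) c = refl
  regroup : ∀ a d s x → a * (d * (s * x)) ≡ s * a * d * x
  regroup = solve-∀
  term : ∀ j → A zero j * f (A [ zero ]≔ δ j) ≡ laplaceTerm A j * f 1ᴹ
  term j = begin
    A zero j * f (A [ zero ]≔ δ j)
      ≡⟨ cong (A zero j *_) (clearColumn alt A j) ⟩
    A zero j * f (expandAt j (minor j A))
      ≡⟨ cong (A zero j *_) (alternating-unique m (expandAt-isAlternating alt j) (minor j A)) ⟩
    A zero j * (det m (minor j A) * f (expandAt j 1ᴹ))
      ≡⟨ cong (λ x → A zero j * (det m (minor j A) * x)) (expandAt-1ᴹ alt j) ⟩
    A zero j * (det m (minor j A) * (sign (toℕ j) * f 1ᴹ))
      ≡⟨ regroup (A zero j) (det m (minor j A)) (sign (toℕ j)) (f 1ᴹ) ⟩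
    laplaceTerm A j * f 1ᴹ                                            ∎

scalar : ℤ → Matrix n
scalar c i j = c * δ i j

det-scalar : ∀ n c → det n (scalar c) ≡ c ^ℤ n
det-scalar zero    c = refl
det-scalar (suc n) c = begin
  det (suc n) S                                  ≡⟨ det-expand n S ⟩
  laplaceTerm S zero + sum (laplaceTerm S ∘ suc) ≡⟨ cong₂ _+_ diagonalTerm (sum-≗0 offDiagonal) ⟩
  c * c ^ℤ n + + 0                               ≡⟨ ℤP.+-identityʳ _ ⟩
  c * c ^ℤ n                                     ∎
  where
  open ≡-Reasoning
  S = scalar {suc n} c
  diagonalTerm : laplaceTerm S zero ≡ c * c ^ℤ n
  diagonalTerm = trans (cong₂ (λ x y → + 1 * x * y) (ℤP.*-identityʳ c) (det-scalar n c))
                       (cong (_* c ^ℤ n) (ℤP.*-identityˡ c))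
  offDiagonal : ∀ j → laplaceTerm S (suc j) ≡ + 0
  offDiagonal j = begin
    sign (toℕ (suc j)) * (c * + 0) * det n (minor (suc j) S)
      ≡⟨ cong (λ x → sign (toℕ (suc j)) * x * det n (minor (suc j) S)) (ℤP.*-zeroʳ c) ⟩
    sign (toℕ (suc j)) * + 0 * det n (minor (suc j) S)
      ≡⟨ cong (_* det n (minor (suc j) S)) (ℤP.*-zeroʳ (sign (toℕ (suc j)))) ⟩
    + 0 * det n (minor (suc j) S)                             ≡⟨ ℤP.*-zeroˡ (det n (minor (suc j) S)) ⟩
    + 0                                                       ∎

1^ℤ : ∀ n → (+ 1) ^ℤ n ≡ + 1
1^ℤ zero    = refl
1^ℤ (suc n) = trans (ℤP.*-identityˡ _) (1^ℤ n)

det-1ᴹ : ∀ n → det n 1ᴹ ≡ + 1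
det-1ᴹ n = trans (det-cong n (λ i j → sym (ℤP.*-identityˡ (δ i j)))) (trans (det-scalar n (+ 1)) (1^ℤ n))

_ᵀ : Mat m n → Mat n m
(A ᵀ) i j = A j i

det∘ᵀ-isAlternating : ∀ n → IsAlternating (det n ∘ _ᵀ)
det∘ᵀ-isAlternating n = record
  { isMultilinear = isMultilinear
  ; alternating   = alternating-fromAdjacent (λ A adj → det-equalAdjacentColumns n (A ᵀ) adj)
  }
  where
  isMultilinear : IsMultilinear (det n ∘ _ᵀ)
  isMultilinear = record
    { resp-≐ = λ A≐B → det-cong n (λ i j → A≐B j i)
    ; linear = λ A B C i a b A≈C B≈C Cᵢ →
        det-linear-column n i a b (λ r c c≢i → A≈C c r c≢i) (λ r c c≢i → B≈C c r c≢i) Cᵢ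
    }
  open MultilinearProperties isMultilinear

det-ᵀ : ∀ n (A : Matrix n) → det n (A ᵀ) ≡ det n A
det-ᵀ n A = begin
  det n (A ᵀ)               ≡⟨ alternating-unique n (det∘ᵀ-isAlternating n) A ⟩
  det n A * det n (1ᴹ ᵀ)    ≡⟨ cong (det n A *_) (trans (det-cong n (λ i j → δ-sym j i)) (det-1ᴹ n)) ⟩
  det n A * + 1             ≡⟨ ℤP.*-identityʳ (det n A) ⟩
  det n A                   ∎
  where open ≡-Reasoning

det-isAlternating : ∀ n → IsAlternating (det n)
det-isAlternating n = record
  { isMultilinear = record
    { resp-≐ = det-cong n
    ; linear = λ A B C i a b A≈C B≈C Cᵢ → begin
        det n C                          ≡⟨ det-ᵀ n C ⟨
        det n (C ᵀ)                      ≡⟨ linear A B C i a b A≈C B≈C Cᵢ ⟩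
        a * det n (A ᵀ) + b * det n (B ᵀ) ≡⟨ cong₂ (λ x y → a * x + b * y) (det-ᵀ n A) (det-ᵀ n B) ⟩
        a * det n A + b * det n B        ∎
    }
  ; alternating = λ A i≢k Aᵢ≗Aₖ → trans (sym (det-ᵀ n A)) (alternating A i≢k Aᵢ≗Aₖ)
  }
  where
  open ≡-Reasoning
  open IsAlternating (det∘ᵀ-isAlternating n)

infixl 7 _*ᴹ_
_*ᴹ_ : Mat m n → Mat n o → Mat m o
(A *ᴹ B) i j = sum (λ l → A i l * B l j)

*ᴹ-identityˡ : (B : Mat m n) → 1ᴹ *ᴹ B ≐ B
*ᴹ-identityˡ B i j = sum-δˡ i (λ l → B l j)

*ᴹ-identityʳ : (B : Mat m n) → B *ᴹ 1ᴹ ≐ B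
*ᴹ-identityʳ B i j = trans (sum-cong-≗ (λ l → ℤP.*-comm (B i l) (δ l j))) (sum-δʳ j (B i))

det-*ᴹ : ∀ n (A B : Matrix n) → det n (A *ᴹ B) ≡ det n A * det n B
det-*ᴹ n A B = trans (alternating-unique n (record { isMultilinear = multilinear′ ; alternating = alternating′ }) A)
                     (cong (det n A *_) (det-cong n (*ᴹ-identityˡ B)))
  where
  open IsAlternating (det-isAlternating n)
  distrib : ∀ a b x y z → (a * x + b * y) * z ≡ a * (x * z) + b * (y * z)
  distrib = solve-∀
  multilinear′ : IsMultilinear (λ X → det n (X *ᴹ B))
  multilinear′ = record
    { resp-≐ = λ X≐Y → det-cong n (λ i j → sum-cong-≗ (λ l → cong (_* B l j) (X≐Y i l)))
    ; linear = λ X Y Z i a b X≈Z Y≈Z Zᵢ → linear (X *ᴹ B) (Y *ᴹ B) (Z *ᴹ B) i a b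
        (λ r c r≢i → sum-cong-≗ (λ l → cong (_* B l c) (X≈Z r l r≢i)))
        (λ r c r≢i → sum-cong-≗ (λ l → cong (_* B l c) (Y≈Z r l r≢i)))
        (λ c → trans (sum-cong-≗ (λ l → trans (cong (_* B l c) (Zᵢ l)) (distrib a b (X i l) (Y i l) (B l c))))
                     (sum-linear a b (λ l → X i l * B l c) (λ l → Y i l * B l c)))
    }
  alternating′ : ∀ X {i k} → i ≢ k → (∀ c → X i c ≡ X k c) → det n (X *ᴹ B) ≡ + 0
  alternating′ X i≢k Xᵢ≗Xₖ = alternating (X *ᴹ B) i≢k (λ c → sum-cong-≗ (λ l → cong (_* B l c) (Xᵢ≗Xₖ l)))


det-*ᴹ-unimodularˡ : ∀ n {L : Matrix n} (M : Matrix n) → det n L ≡ + 1 → det n (L *ᴹ M) ≡ det n M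
det-*ᴹ-unimodularˡ n {L} M det-L≡1 =
  trans (det-*ᴹ n L M) (trans (cong (_* det n M) det-L≡1) (ℤP.*-identityˡ (det n M)))

det-*ᴹ-unimodularʳ : ∀ n {R : Matrix n} (M : Matrix n) → det n R ≡ + 1 → det n (M *ᴹ R) ≡ det n M
det-*ᴹ-unimodularʳ n {R} M det-R≡1 =
  trans (det-*ᴹ n M R) (trans (cong (det n M *_) det-R≡1) (ℤP.*-identityʳ (det n M)))

-- Block matrices

0ᴹ : Mat m n
0ᴹ _ _ = + 0

-ᴹ_ : Mat m n → Mat m n
(-ᴹ A) i j = - A i j

infixl 6 _+ᴹ_
_+ᴹ_ : Mat m n → Mat m n → Mat m n
(A +ᴹ B) i j = A i j + B i j

charMatrix : ℤ → Matrix n → Matrix n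
charMatrix t A i j = t * δ i j - A i j

*ᴹ-zeroˡ : (B : Mat n o) → 0ᴹ {m} *ᴹ B ≐ 0ᴹ
*ᴹ-zeroˡ B i j = sum-≗0 (λ l → ℤP.*-zeroˡ (B l j))

*ᴹ-zeroʳ : (A : Mat m n) → A *ᴹ 0ᴹ {n} {o} ≐ 0ᴹ
*ᴹ-zeroʳ A i j = sum-≗0 (λ l → ℤP.*-zeroʳ (A i l))

*ᴹ-negˡ : (A : Mat m n) (B : Mat n o) → (-ᴹ A) *ᴹ B ≐ -ᴹ (A *ᴹ B)
*ᴹ-negˡ A B i j = trans (sum-cong-≗ (λ l → sym (ℤP.neg-distribˡ-* (A i l) (B l j)))) (sum-neg (λ l → A i l * B l j))

*ᴹ-negʳ : (A : Mat m n) (B : Mat n o) → A *ᴹ (-ᴹ B) ≐ -ᴹ (A *ᴹ B)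
*ᴹ-negʳ A B i j = trans (sum-cong-≗ (λ l → sym (ℤP.neg-distribʳ-* (A i l) (B l j)))) (sum-neg (λ l → A i l * B l j))

*ᴹ-scalarˡ : (t : ℤ) (A : Mat m n) → scalar t *ᴹ A ≐ λ i j → t * A i j
*ᴹ-scalarˡ t A i j = begin
  sum (λ l → t * δ i l * A l j)    ≡⟨ sum-cong-≗ (λ l → ℤP.*-assoc t (δ i l) (A l j)) ⟩
  sum (λ l → t * (δ i l * A l j))  ≡⟨ *-distribˡ-sum t (λ l → δ i l * A l j) ⟨
  t * sum (λ l → δ i l * A l j)    ≡⟨ cong (t *_) (sum-δˡ i (λ l → A l j)) ⟩
  t * A i j                        ∎
  where open ≡-Reasoning

*ᴹ-scalarʳ : (t : ℤ) (A : Mat m n) → A *ᴹ scalar t ≐ λ i j → A i j * t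
*ᴹ-scalarʳ t A i j = begin
  sum (λ l → A i l * (t * δ l j))  ≡⟨ sum-cong-≗ (λ l → regroup (A i l) t (δ l j)) ⟩
  sum (λ l → δ l j * A i l * t)    ≡⟨ *-distribʳ-sum t (λ l → δ l j * A i l) ⟨
  sum (λ l → δ l j * A i l) * t    ≡⟨ cong (_* t) (sum-δʳ j (A i)) ⟩
  A i j * t                        ∎
  where
  open ≡-Reasoning
  regroup : ∀ x t d → x * (t * d) ≡ d * x * t
  regroup = solve-∀

block : Mat n n → Mat n m → Mat m n → Mat m m → Matrix (n ℕ.+ m)
block P Q R S = (λ i → P i ++ Q i) ++ (λ i → R i ++ S i)

module _ (P : Mat n n) (Q : Mat n m) (R : Mat m n) (S : Mat m m) where
  block-ˡˡ : ∀ i j → block P Q R S (i ↑ˡ m) (j ↑ˡ m) ≡ P i j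
  block-ˡˡ i j = trans (cong-app (lookup-++ˡ (λ i → P i ++ Q i) (λ i → R i ++ S i) i) (j ↑ˡ m)) (lookup-++ˡ (P i) (Q i) j)

  block-ˡʳ : ∀ i j → block P Q R S (i ↑ˡ m) (n ↑ʳ j) ≡ Q i j
  block-ˡʳ i j = trans (cong-app (lookup-++ˡ (λ i → P i ++ Q i) (λ i → R i ++ S i) i) (n ↑ʳ j)) (lookup-++ʳ (P i) (Q i) j)

  block-ʳˡ : ∀ i j → block P Q R S (n ↑ʳ i) (j ↑ˡ m) ≡ R i j
  block-ʳˡ i j = trans (cong-app (lookup-++ʳ {m = n} (λ i → P i ++ Q i) (λ i → R i ++ S i) i) (j ↑ˡ m))
                       (lookup-++ˡ (R i) (S i) j)

  block-ʳʳ : ∀ i j → block P Q R S (n ↑ʳ i) (n ↑ʳ j) ≡ S i j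
  block-ʳʳ i j = trans (cong-app (lookup-++ʳ {m = n} (λ i → P i ++ Q i) (λ i → R i ++ S i) i) (n ↑ʳ j))
                       (lookup-++ʳ (R i) (S i) j)

data Halves (n m : ℕ) : Fin (n ℕ.+ m) → Set where
  left  : (i : Fin n) → Halves n m (i ↑ˡ m)
  right : (i : Fin m) → Halves n m (n ↑ʳ i)

halves : ∀ n {m} (i : Fin (n ℕ.+ m)) → Halves n m i
halves n {m} i with Fin.splitAt n i in eq
... | inj₁ i′ = subst (Halves n m) (FinP.splitAt⁻¹-↑ˡ eq) (left i′)
... | inj₂ i′ = subst (Halves n m) (FinP.splitAt⁻¹-↑ʳ eq) (right i′)

≐-block : {X : Matrix (n ℕ.+ m)} {P : Mat n n} {Q : Mat n m} {R : Mat m n} {S : Mat m m} →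
          (∀ i j → X (i ↑ˡ m) (j ↑ˡ m) ≡ P i j) → (∀ i j → X (i ↑ˡ m) (n ↑ʳ j) ≡ Q i j) →
          (∀ i j → X (n ↑ʳ i) (j ↑ˡ m) ≡ R i j) → (∀ i j → X (n ↑ʳ i) (n ↑ʳ j) ≡ S i j) →
          X ≐ block P Q R S
≐-block {n} {P = P} {Q} {R} {S} ll lr rl rr i j with halves n i | halves n j
... | left i  | left j  = trans (ll i j) (sym (block-ˡˡ P Q R S i j))
... | left i  | right j = trans (lr i j) (sym (block-ˡʳ P Q R S i j))
... | right i | left j  = trans (rl i j) (sym (block-ʳˡ P Q R S i j))
... | right i | right j = trans (rr i j) (sym (block-ʳʳ P Q R S i j))

block-*ᴹ : (P : Mat n n) (Q : Mat n m) (R : Mat m n) (S : Mat m m)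
           (P′ : Mat n n) (Q′ : Mat n m) (R′ : Mat m n) (S′ : Mat m m) →
           block P Q R S *ᴹ block P′ Q′ R′ S′ ≐
           block (P *ᴹ P′ +ᴹ Q *ᴹ R′) (P *ᴹ Q′ +ᴹ Q *ᴹ S′) (R *ᴹ P′ +ᴹ S *ᴹ R′) (R *ᴹ Q′ +ᴹ S *ᴹ S′)
block-*ᴹ {n} {m} P Q R S P′ Q′ R′ S′ = ≐-block
  (λ i j → entry (block-ˡˡ P Q R S i) (λ l → block-ˡˡ P′ Q′ R′ S′ l j)
                 (block-ˡʳ P Q R S i) (λ l → block-ʳˡ P′ Q′ R′ S′ l j))
  (λ i j → entry (block-ˡˡ P Q R S i) (λ l → block-ˡʳ P′ Q′ R′ S′ l j)
                 (block-ˡʳ P Q R S i) (λ l → block-ʳʳ P′ Q′ R′ S′ l j))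
  (λ i j → entry (block-ʳˡ P Q R S i) (λ l → block-ˡˡ P′ Q′ R′ S′ l j)
                 (block-ʳʳ P Q R S i) (λ l → block-ʳˡ P′ Q′ R′ S′ l j))
  (λ i j → entry (block-ʳˡ P Q R S i) (λ l → block-ˡʳ P′ Q′ R′ S′ l j)
                 (block-ʳʳ P Q R S i) (λ l → block-ʳʳ P′ Q′ R′ S′ l j))
  where
  X = block P Q R S
  Y = block P′ Q′ R′ S′
  entry : ∀ {a b} {u v : Fin n → ℤ} {u′ v′ : Fin m → ℤ} →
          (∀ l → X a (l ↑ˡ m) ≡ u l) → (∀ l → Y (l ↑ˡ m) b ≡ v l) →
          (∀ l → X a (n ↑ʳ l) ≡ u′ l) → (∀ l → Y (n ↑ʳ l) b ≡ v′ l) →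
          (X *ᴹ Y) a b ≡ sum (λ l → u l * v l) + sum (λ l → u′ l * v′ l)
  entry u≗ v≗ u′≗ v′≗ = trans (sum-split n _) (cong₂ _+_ (sum-cong-≗ (λ l → cong₂ _*_ (u≗ l) (v≗ l)))
                                                    (sum-cong-≗ (λ l → cong₂ _*_ (u′≗ l) (v′≗ l))))

block-cong : {P P′ : Mat n n} {Q Q′ : Mat n m} {R R′ : Mat m n} {S S′ : Mat m m} →
             P ≐ P′ → Q ≐ Q′ → R ≐ R′ → S ≐ S′ → block P Q R S ≐ block P′ Q′ R′ S′
block-cong {P = P} {Q = Q} {R = R} {S = S} P≐ Q≐ R≐ S≐ = ≐-block
  (λ i j → trans (block-ˡˡ P Q R S i j) (P≐ i j)) (λ i j → trans (block-ˡʳ P Q R S i j) (Q≐ i j))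
  (λ i j → trans (block-ʳˡ P Q R S i j) (R≐ i j)) (λ i j → trans (block-ʳʳ P Q R S i j) (S≐ i j))

block-ᵀ : (P : Mat n n) (Q : Mat n m) (S : Mat m m) → block P Q 0ᴹ S ᵀ ≐ block (P ᵀ) 0ᴹ (Q ᵀ) (S ᵀ)
block-ᵀ P Q S = ≐-block (λ i j → block-ˡˡ P Q 0ᴹ S j i) (λ i j → block-ʳˡ P Q 0ᴹ S j i)
                        (λ i j → block-ˡʳ P Q 0ᴹ S j i) (λ i j → block-ʳʳ P Q 0ᴹ S j i)

charMatrix-block : {X : Matrix (n ℕ.+ n)} {P Q R S : Matrix n} (t : ℤ) → X ≐ block P Q R S →
                   charMatrix t X ≐ block (charMatrix t P) (-ᴹ Q) (-ᴹ R) (charMatrix t S)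
charMatrix-block {n} {P = P} {Q} {R} {S} t X≐ = ≐-block
  (λ i j → cong₂ (λ d x → t * d - x) (δ-cong-injective (_↑ˡ n) (FinP.↑ˡ-injective n _ _) i j)
                                     (trans (X≐ _ _) (block-ˡˡ P Q R S i j)))
  (λ i j → trans (cong₂ (λ d x → t * d - x) (δ-↑ˡ-↑ʳ i j) (trans (X≐ _ _) (block-ˡʳ P Q R S i j)))
                 (no-diagonal t (Q i j)))
  (λ i j → trans (cong₂ (λ d x → t * d - x) (δ-↑ʳ-↑ˡ j i) (trans (X≐ _ _) (block-ʳˡ P Q R S i j)))
                 (no-diagonal t (R i j)))
  (λ i j → cong₂ (λ d x → t * d - x) (δ-cong-injective (n ↑ʳ_) (FinP.↑ʳ-injective n _ _) i j)
                                     (trans (X≐ _ _) (block-ʳʳ P Q R S i j)))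
  where
  no-diagonal : ∀ t x → t * + 0 - x ≡ - x
  no-diagonal = solve-∀

punchIn-↑ˡ : ∀ (j : Fin (suc n)) (c : Fin n) → punchIn (j ↑ˡ m) (c ↑ˡ m) ≡ punchIn j c ↑ˡ m
punchIn-↑ˡ zero    c       = refl
punchIn-↑ˡ (suc j) zero    = refl
punchIn-↑ˡ (suc j) (suc c) = cong suc (punchIn-↑ˡ j c)

punchIn-↑ʳ : ∀ (j : Fin (suc n)) (c : Fin m) → punchIn (j ↑ˡ m) (n ↑ʳ c) ≡ suc n ↑ʳ c
punchIn-↑ʳ             zero    c = refl
punchIn-↑ʳ {n = suc n} (suc j) c = cong suc (punchIn-↑ʳ j c)

det-block-lower : ∀ n (P : Mat n n) (R : Mat m n) (S : Mat m m) → det (n ℕ.+ m) (block P 0ᴹ R S) ≡ det n P * det m S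
det-block-lower zero    P R S = sym (ℤP.*-identityˡ _)
det-block-lower {m} (suc n) P R S = begin
  det (suc n ℕ.+ m) M                                                    ≡⟨ det-expand (n ℕ.+ m) M ⟩
  sum (laplaceTerm M)
    ≡⟨ sum-split (suc n) (laplaceTerm M) ⟩
  sum (λ j → laplaceTerm M (j ↑ˡ m)) + sum (λ c → laplaceTerm M (suc n ↑ʳ c))
    ≡⟨ cong₂ _+_ (sum-cong-≗ leftTerm) (sum-≗0 rightTerm) ⟩
  sum (λ j → laplaceTerm P j * det m S) + + 0                            ≡⟨ ℤP.+-identityʳ _ ⟩
  sum (λ j → laplaceTerm P j * det m S)
    ≡⟨ *-distribʳ-sum (det m S) (laplaceTerm P) ⟨
  sum (laplaceTerm P) * det m S
    ≡⟨ cong (_* det m S) (det-expand n P) ⟨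
  det (suc n) P * det m S                                                ∎
  where
  open ≡-Reasoning
  M = block P 0ᴹ R S
  minor-block : ∀ j → minor (j ↑ˡ m) M ≐ block (minor j P) 0ᴹ (λ r c → R r (punchIn j c)) S
  minor-block j = ≐-block
    (λ r c → trans (cong (M (suc r ↑ˡ m)) (punchIn-↑ˡ j c)) (block-ˡˡ P 0ᴹ R S (suc r) (punchIn j c)))
    (λ r c → trans (cong (M (suc r ↑ˡ m)) (punchIn-↑ʳ j c)) (block-ˡʳ P 0ᴹ R S (suc r) c))
    (λ r c → trans (cong (M (suc n ↑ʳ r)) (punchIn-↑ˡ j c)) (block-ʳˡ P 0ᴹ R S r (punchIn j c)))
    (λ r c → trans (cong (M (suc n ↑ʳ r)) (punchIn-↑ʳ j c)) (block-ʳʳ P 0ᴹ R S r c))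
  regroup : ∀ s x d e → s * x * (d * e) ≡ s * x * d * e
  regroup = solve-∀
  leftTerm : ∀ j → laplaceTerm M (j ↑ˡ m) ≡ laplaceTerm P j * det m S
  leftTerm j = begin
    sign (toℕ (j ↑ˡ m)) * M zero (j ↑ˡ m) * det (n ℕ.+ m) (minor (j ↑ˡ m) M)
      ≡⟨ cong₂ (λ s x → sign s * x * det (n ℕ.+ m) (minor (j ↑ˡ m) M)) (FinP.toℕ-↑ˡ j m) (block-ˡˡ P 0ᴹ R S zero j) ⟩
    sign (toℕ j) * P zero j * det (n ℕ.+ m) (minor (j ↑ˡ m) M)
      ≡⟨ cong (sign (toℕ j) * P zero j *_) (trans (det-cong (n ℕ.+ m) (minor-block j)) (det-block-lower n _ _ S)) ⟩
    sign (toℕ j) * P zero j * (det n (minor j P) * det m S)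
      ≡⟨ regroup (sign (toℕ j)) (P zero j) (det n (minor j P)) (det m S) ⟩
    laplaceTerm P j * det m S  ∎
  rightTerm : ∀ c → laplaceTerm M (suc n ↑ʳ c) ≡ + 0
  rightTerm c = trans (cong (λ x → sign (toℕ (suc n ↑ʳ c)) * x * det (n ℕ.+ m) (minor (suc n ↑ʳ c) M))
                            (block-ˡʳ P 0ᴹ R S zero c))
                      (trans (cong (_* det (n ℕ.+ m) (minor (suc n ↑ʳ c) M)) (ℤP.*-zeroʳ (sign (toℕ (suc n ↑ʳ c)))))
                             (ℤP.*-zeroˡ (det (n ℕ.+ m) (minor (suc n ↑ʳ c) M))))

det-block-upper : ∀ n (P : Mat n n) (Q : Mat n m) (S : Mat m m) → det (n ℕ.+ m) (block P Q 0ᴹ S) ≡ det n P * det m S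
det-block-upper {m} n P Q S = begin
  det (n ℕ.+ m) (block P Q 0ᴹ S)            ≡⟨ det-ᵀ (n ℕ.+ m) _ ⟨
  det (n ℕ.+ m) (block P Q 0ᴹ S ᵀ)          ≡⟨ det-cong (n ℕ.+ m) (block-ᵀ P Q S) ⟩
  det (n ℕ.+ m) (block (P ᵀ) 0ᴹ (Q ᵀ) (S ᵀ)) ≡⟨ det-block-lower n (P ᵀ) (Q ᵀ) (S ᵀ) ⟩
  det n (P ᵀ) * det m (S ᵀ)                 ≡⟨ cong₂ _*_ (det-ᵀ n P) (det-ᵀ m S) ⟩
  det n P * det m S                         ∎
  where open ≡-Reasoning


-- Sylvester's determinant identity

^ℤ-distribˡ-+ : ∀ t a b → t ^ℤ (a ℕ.+ b) ≡ t ^ℤ a * t ^ℤ b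
^ℤ-distribˡ-+ t zero    b = sym (ℤP.*-identityˡ _)
^ℤ-distribˡ-+ t (suc a) b = trans (cong (t *_) (^ℤ-distribˡ-+ t a b)) (sym (ℤP.*-assoc t _ _))

^ℤ-≢0 : ∀ {t} n → t ≢ + 0 → t ^ℤ n ≢ + 0
^ℤ-≢0 (suc n) t≢0 tⁿ⁺¹≡0 with ℤP.i*j≡0⇒i≡0∨j≡0 _ tⁿ⁺¹≡0
... | inj₁ t≡0  = t≢0 t≡0
... | inj₂ tⁿ≡0 = ^ℤ-≢0 n t≢0 tⁿ≡0

det-neg : ∀ n (A : Matrix n) → det n (-ᴹ A) ≡ (- + 1) ^ℤ n * det n A
det-neg n A = begin
  det n (-ᴹ A)
    ≡⟨ det-cong n (λ i j → sym (trans (*ᴹ-scalarˡ (- + 1) A i j) (ℤP.-1*i≡-i (A i j)))) ⟩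
  det n (scalar (- + 1) *ᴹ A)     ≡⟨ det-*ᴹ n (scalar (- + 1)) A ⟩
  det n (scalar (- + 1)) * det n A ≡⟨ cong (_* det n A) (det-scalar n (- + 1)) ⟩
  (- + 1) ^ℤ n * det n A          ∎
  where open ≡-Reasoning

charPoly≡det-charMatrix : (A : Matrix n) (t : ℤ) → charPoly A t ≡ det n (charMatrix t A)
charPoly≡det-charMatrix {n} A t = det-cong n (λ i j → cong (_- A i j) (diagonal (i ==ᶠ j)))
  where
  diagonal : ∀ b → (if b then t else + 0) ≡ t * boolToℤ b
  diagonal true  = sym (ℤP.*-identityʳ t)
  diagonal false = sym (ℤP.*-zeroʳ t)

module _ (n e : ℕ) (N : Mat n (n ℕ.+ e)) (t : ℤ) where
  private
    n+e = n ℕ.+ e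
    X = block 1ᴹ N (N ᵀ) (scalar t)

    det-block-charMatrix-ᵀ*ᴹ : det (n ℕ.+ n+e) X ≡ det n+e (charMatrix t (N ᵀ *ᴹ N))
    det-block-charMatrix-ᵀ*ᴹ = begin
      det (n ℕ.+ n+e) X                                          ≡⟨ det-*ᴹ-unimodularˡ (n ℕ.+ n+e) X det-L ⟨
      det (n ℕ.+ n+e) (L *ᴹ X)                                   ≡⟨ det-cong (n ℕ.+ n+e) L*X ⟩
      det (n ℕ.+ n+e) (block 1ᴹ N 0ᴹ (charMatrix t (N ᵀ *ᴹ N)))  ≡⟨ det-block-upper n 1ᴹ N _ ⟩
      det n 1ᴹ * det n+e (charMatrix t (N ᵀ *ᴹ N))
        ≡⟨ cong (_* det n+e (charMatrix t (N ᵀ *ᴹ N))) (det-1ᴹ n) ⟩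
      + 1 * det n+e (charMatrix t (N ᵀ *ᴹ N))                    ≡⟨ ℤP.*-identityˡ _ ⟩
      det n+e (charMatrix t (N ᵀ *ᴹ N))                          ∎
      where
      open ≡-Reasoning
      L = block 1ᴹ 0ᴹ (-ᴹ (N ᵀ)) 1ᴹ
      det-L : det (n ℕ.+ n+e) L ≡ + 1
      det-L = trans (det-block-lower n 1ᴹ _ 1ᴹ) (cong₂ _*_ (det-1ᴹ n) (det-1ᴹ n+e))
      p : 1ᴹ *ᴹ 1ᴹ +ᴹ 0ᴹ *ᴹ N ᵀ ≐ 1ᴹ
      p i j = trans (cong₂ _+_ (*ᴹ-identityˡ 1ᴹ i j) (*ᴹ-zeroˡ (N ᵀ) i j)) (ℤP.+-identityʳ _)
      q : 1ᴹ *ᴹ N +ᴹ 0ᴹ *ᴹ scalar t ≐ N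
      q i j = trans (cong₂ _+_ (*ᴹ-identityˡ N i j) (*ᴹ-zeroˡ (scalar t) i j)) (ℤP.+-identityʳ _)
      r : (-ᴹ (N ᵀ)) *ᴹ 1ᴹ +ᴹ 1ᴹ *ᴹ N ᵀ ≐ 0ᴹ
      r i j = trans (cong₂ _+_ (*ᴹ-identityʳ (-ᴹ (N ᵀ)) i j) (*ᴹ-identityˡ (N ᵀ) i j)) (ℤP.+-inverseˡ (N j i))
      s : (-ᴹ (N ᵀ)) *ᴹ N +ᴹ 1ᴹ *ᴹ scalar t ≐ charMatrix t (N ᵀ *ᴹ N)
      s i j = trans (cong₂ _+_ (*ᴹ-negˡ (N ᵀ) N i j) (*ᴹ-identityˡ (scalar t) i j))
                    (ℤP.+-comm (- (N ᵀ *ᴹ N) i j) (scalar t i j))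
      L*X : L *ᴹ X ≐ block 1ᴹ N 0ᴹ (charMatrix t (N ᵀ *ᴹ N))
      L*X i j = trans (block-*ᴹ 1ᴹ 0ᴹ (-ᴹ (N ᵀ)) 1ᴹ 1ᴹ N (N ᵀ) (scalar t) i j) (block-cong p q r s i j)

    det-block-charMatrix-*ᴹᵀ : det (n ℕ.+ n+e) X * t ^ℤ n ≡ det n (charMatrix t (N *ᴹ N ᵀ)) * t ^ℤ n+e
    det-block-charMatrix-*ᴹᵀ = begin
      det (n ℕ.+ n+e) X * t ^ℤ n
        ≡⟨ cong (det (n ℕ.+ n+e) X *_) det-R ⟨
      det (n ℕ.+ n+e) X * det (n ℕ.+ n+e) R                              ≡⟨ det-*ᴹ (n ℕ.+ n+e) X R ⟨
      det (n ℕ.+ n+e) (X *ᴹ R)                                           ≡⟨ det-cong (n ℕ.+ n+e) X*R ⟩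
      det (n ℕ.+ n+e) (block (charMatrix t (N *ᴹ N ᵀ)) N 0ᴹ (scalar t))  ≡⟨ det-block-upper n _ N (scalar t) ⟩
      det n (charMatrix t (N *ᴹ N ᵀ)) * det n+e (scalar t)
        ≡⟨ cong (det n (charMatrix t (N *ᴹ N ᵀ)) *_) (det-scalar n+e t) ⟩
      det n (charMatrix t (N *ᴹ N ᵀ)) * t ^ℤ n+e                         ∎
      where
      open ≡-Reasoning
      R = block (scalar t) 0ᴹ (-ᴹ (N ᵀ)) 1ᴹ
      det-R : det (n ℕ.+ n+e) R ≡ t ^ℤ n
      det-R = trans (det-block-lower n (scalar t) _ 1ᴹ)
                    (trans (cong₂ _*_ (det-scalar n t) (det-1ᴹ n+e)) (ℤP.*-identityʳ _))
      cancel : ∀ x t → x * t + t * (- x) ≡ + 0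
      cancel = solve-∀
      p : 1ᴹ *ᴹ scalar t +ᴹ N *ᴹ (-ᴹ (N ᵀ)) ≐ charMatrix t (N *ᴹ N ᵀ)
      p i j = cong₂ _+_ (*ᴹ-identityˡ (scalar t) i j) (*ᴹ-negʳ N (N ᵀ) i j)
      q : 1ᴹ *ᴹ 0ᴹ +ᴹ N *ᴹ 1ᴹ ≐ N
      q i j = trans (cong₂ _+_ (*ᴹ-zeroʳ 1ᴹ i j) (*ᴹ-identityʳ N i j)) (ℤP.+-identityˡ _)
      r : N ᵀ *ᴹ scalar t +ᴹ scalar t *ᴹ (-ᴹ (N ᵀ)) ≐ 0ᴹ
      r i j = trans (cong₂ _+_ (*ᴹ-scalarʳ t (N ᵀ) i j) (*ᴹ-scalarˡ t (-ᴹ (N ᵀ)) i j)) (cancel (N j i) t)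
      s : N ᵀ *ᴹ 0ᴹ +ᴹ scalar t *ᴹ 1ᴹ ≐ scalar t
      s i j = trans (cong₂ _+_ (*ᴹ-zeroʳ (N ᵀ) i j) (*ᴹ-identityʳ (scalar t) i j)) (ℤP.+-identityˡ _)
      X*R : X *ᴹ R ≐ block (charMatrix t (N *ᴹ N ᵀ)) N 0ᴹ (scalar t)
      X*R i j = trans (block-*ᴹ 1ᴹ N (N ᵀ) (scalar t) (scalar t) 0ᴹ (-ᴹ (N ᵀ)) 1ᴹ i j) (block-cong p q r s i j)

  sylvester-scaled : det n+e (charMatrix t (N ᵀ *ᴹ N)) * t ^ℤ n ≡ t ^ℤ e * det n (charMatrix t (N *ᴹ N ᵀ)) * t ^ℤ n
  sylvester-scaled = begin
    det n+e (charMatrix t (N ᵀ *ᴹ N)) * t ^ℤ n        ≡⟨ cong (_* t ^ℤ n) det-block-charMatrix-ᵀ*ᴹ ⟨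
    det (n ℕ.+ n+e) X * t ^ℤ n                        ≡⟨ det-block-charMatrix-*ᴹᵀ ⟩
    det n (charMatrix t (N *ᴹ N ᵀ)) * t ^ℤ n+e
      ≡⟨ cong (det n (charMatrix t (N *ᴹ N ᵀ)) *_) (^ℤ-distribˡ-+ t n e) ⟩
    det n (charMatrix t (N *ᴹ N ᵀ)) * (t ^ℤ n * t ^ℤ e)
      ≡⟨ regroup (det n (charMatrix t (N *ᴹ N ᵀ))) (t ^ℤ n) (t ^ℤ e) ⟩
    t ^ℤ e * det n (charMatrix t (N *ᴹ N ᵀ)) * t ^ℤ n  ∎
    where
    open ≡-Reasoning
    regroup : ∀ d a b → d * (a * b) ≡ b * d * a
    regroup = solve-∀

private
  charMatrix-0 : (A : Matrix n) → charMatrix (+ 0) A ≐ -ᴹ A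
  charMatrix-0 A i j = ℤP.+-identityˡ (- A i j)

  det-negᵀ*ᴹ-square : ∀ n m → n ≡ m → (N : Mat n m) → det m ((-ᴹ (N ᵀ)) *ᴹ N) ≡ det n (N *ᴹ (-ᴹ (N ᵀ)))
  det-negᵀ*ᴹ-square n .n refl N = begin
    det n ((-ᴹ (N ᵀ)) *ᴹ N)       ≡⟨ det-*ᴹ n (-ᴹ (N ᵀ)) N ⟩
    det n (-ᴹ (N ᵀ)) * det n N    ≡⟨ ℤP.*-comm (det n (-ᴹ (N ᵀ))) (det n N) ⟩
    det n N * det n (-ᴹ (N ᵀ))    ≡⟨ det-*ᴹ n N (-ᴹ (N ᵀ)) ⟨
    det n (N *ᴹ (-ᴹ (N ᵀ)))       ∎
    where open ≡-Reasoning

  det-negᵀ*ᴹ-wide : ∀ n e (N : Mat n (n ℕ.+ suc e)) → det (n ℕ.+ suc e) ((-ᴹ (N ᵀ)) *ᴹ N) ≡ + 0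
  det-negᵀ*ᴹ-wide n e N = begin
    det n+1+e ((-ᴹ (N ᵀ)) *ᴹ N)           ≡⟨ det-cong n+1+e padded ⟩
    det n+1+e ((-ᴹ (N′ ᵀ)) *ᴹ N′)         ≡⟨ det-*ᴹ n+1+e (-ᴹ (N′ ᵀ)) N′ ⟩
    det n+1+e (-ᴹ (N′ ᵀ)) * det n+1+e N′
      ≡⟨ cong (det n+1+e (-ᴹ (N′ ᵀ)) *_) (zeroRow N′ (n ↑ʳ zero) (λ c → cong-app (lookup-++ʳ N 0ᴹ zero) c)) ⟩
    det n+1+e (-ᴹ (N′ ᵀ)) * + 0           ≡⟨ ℤP.*-zeroʳ (det n+1+e (-ᴹ (N′ ᵀ))) ⟩
    + 0                               ∎
    where
    open ≡-Reasoning
    open AlternatingProperties (det-isAlternating (n ℕ.+ suc e))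
    n+1+e = n ℕ.+ suc e
    N′ : Matrix n+1+e
    N′ = N ++ 0ᴹ
    padded : (-ᴹ (N ᵀ)) *ᴹ N ≐ (-ᴹ (N′ ᵀ)) *ᴹ N′
    padded i j = sym (trans (sum-split n (λ l → - N′ l i * N′ l j))
      (trans (cong₂ _+_ (sum-cong-≗ (λ l → cong₂ (λ x y → - x * y) (cong-app (lookup-++ˡ N 0ᴹ l) i)
                                                                  (cong-app (lookup-++ˡ N 0ᴹ l) j)))
                        (sum-≗0 (λ l → trans (cong (λ y → - N′ (n ↑ʳ l) i * y) (cong-app (lookup-++ʳ N 0ᴹ l) j))
                                             (ℤP.*-zeroʳ (- N′ (n ↑ʳ l) i)))))
             (ℤP.+-identityʳ _)))

  -- At t = 0 the factor tⁿ cannot be cancelled; for e > 0 both sides vanish because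
  -- NᵀN factors through an n-dimensional space (pad N with zero rows).
  sylvester-0 : ∀ n e (N : Mat n (n ℕ.+ e)) →
                det (n ℕ.+ e) (charMatrix (+ 0) (N ᵀ *ᴹ N)) ≡ (+ 0) ^ℤ e * det n (charMatrix (+ 0) (N *ᴹ N ᵀ))
  sylvester-0 n zero N = begin
    det (n ℕ.+ 0) (charMatrix (+ 0) (N ᵀ *ᴹ N))
      ≡⟨ det-cong (n ℕ.+ 0) (λ i j → trans (charMatrix-0 (N ᵀ *ᴹ N) i j) (sym (*ᴹ-negˡ (N ᵀ) N i j))) ⟩
    det (n ℕ.+ 0) ((-ᴹ (N ᵀ)) *ᴹ N)              ≡⟨ det-negᵀ*ᴹ-square n (n ℕ.+ 0) (sym (ℕP.+-identityʳ n)) N ⟩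
    det n (N *ᴹ (-ᴹ (N ᵀ)))
      ≡⟨ det-cong n (λ i j → trans (*ᴹ-negʳ N (N ᵀ) i j) (sym (charMatrix-0 (N *ᴹ N ᵀ) i j))) ⟩
    det n (charMatrix (+ 0) (N *ᴹ N ᵀ))          ≡⟨ ℤP.*-identityˡ _ ⟨
    + 1 * det n (charMatrix (+ 0) (N *ᴹ N ᵀ))    ∎
    where open ≡-Reasoning
  sylvester-0 n (suc e) N = begin
    det (n ℕ.+ suc e) (charMatrix (+ 0) (N ᵀ *ᴹ N))
      ≡⟨ det-cong (n ℕ.+ suc e) (λ i j → trans (charMatrix-0 (N ᵀ *ᴹ N) i j) (sym (*ᴹ-negˡ (N ᵀ) N i j))) ⟩
    det (n ℕ.+ suc e) ((-ᴹ (N ᵀ)) *ᴹ N)              ≡⟨ det-negᵀ*ᴹ-wide n e N ⟩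
    + 0
      ≡⟨ ℤP.*-zeroˡ ((+ 0) ^ℤ e * det n (charMatrix (+ 0) (N *ᴹ N ᵀ))) ⟨
    (+ 0) ^ℤ suc e * det n (charMatrix (+ 0) (N *ᴹ N ᵀ))  ∎
    where open ≡-Reasoning

sylvester : ∀ n e {m} → m ≡ n ℕ.+ e → (N : Mat n m) (t : ℤ) →
            det m (charMatrix t (N ᵀ *ᴹ N)) ≡ t ^ℤ e * det n (charMatrix t (N *ᴹ N ᵀ))
sylvester n e refl N t with t ℤ.≟ + 0
... | yes refl = sylvester-0 n e N
... | no t≢0   = ℤP.*-cancelʳ-≡ _ _ (t ^ℤ n) {{ℤ.≢-nonZero (^ℤ-≢0 n t≢0)}} (sylvester-scaled n e N t)

det-block-scalar-neg : ∀ n (s : ℤ) (A : Matrix n) →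
                       det (n ℕ.+ n) (block (scalar s) (-ᴹ A) (-ᴹ A) (scalar s)) ≡
                       det n (charMatrix s (-ᴹ A)) * det n (charMatrix s A)
det-block-scalar-neg n s A = begin
  det (n ℕ.+ n) M                        ≡⟨ det-*ᴹ-unimodularˡ (n ℕ.+ n) M (unitriangular 1ᴹ) ⟨
  det (n ℕ.+ n) (L *ᴹ M)                 ≡⟨ det-cong (n ℕ.+ n) L*M ⟩
  det (n ℕ.+ n) M′                       ≡⟨ det-*ᴹ-unimodularʳ (n ℕ.+ n) M′ (unitriangular (-ᴹ 1ᴹ)) ⟨
  det (n ℕ.+ n) (M′ *ᴹ R)                ≡⟨ det-cong (n ℕ.+ n) M′*R ⟩
  det (n ℕ.+ n) (block K′ (-ᴹ A) 0ᴹ K)   ≡⟨ det-block-upper n K′ (-ᴹ A) K ⟩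
  det n K′ * det n K                     ∎
  where
  open ≡-Reasoning
  K K′ : Matrix n
  K  = charMatrix s A
  K′ = charMatrix s (-ᴹ A)
  M L M′ R : Matrix (n ℕ.+ n)
  M  = block (scalar s) (-ᴹ A) (-ᴹ A) (scalar s)
  L  = block {n = n} {m = n} 1ᴹ 0ᴹ 1ᴹ 1ᴹ
  M′ = block (scalar s) (-ᴹ A) K K
  R  = block {n = n} {m = n} 1ᴹ 0ᴹ (-ᴹ 1ᴹ) 1ᴹ
  unitriangular : (X : Matrix n) → det (n ℕ.+ n) (block 1ᴹ 0ᴹ X 1ᴹ) ≡ + 1
  unitriangular X = trans (det-block-lower n 1ᴹ X 1ᴹ) (cong₂ _*_ (det-1ᴹ n) (det-1ᴹ n))
  p₁ : 1ᴹ *ᴹ scalar s +ᴹ 0ᴹ *ᴹ (-ᴹ A) ≐ scalar s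
  p₁ i j = trans (cong₂ _+_ (*ᴹ-identityˡ (scalar s) i j) (*ᴹ-zeroˡ (-ᴹ A) i j)) (ℤP.+-identityʳ _)
  q₁ : 1ᴹ *ᴹ (-ᴹ A) +ᴹ 0ᴹ *ᴹ scalar s ≐ -ᴹ A
  q₁ i j = trans (cong₂ _+_ (*ᴹ-identityˡ (-ᴹ A) i j) (*ᴹ-zeroˡ (scalar s) i j)) (ℤP.+-identityʳ _)
  r₁ : 1ᴹ *ᴹ scalar s +ᴹ 1ᴹ *ᴹ (-ᴹ A) ≐ K
  r₁ i j = cong₂ _+_ (*ᴹ-identityˡ (scalar s) i j) (*ᴹ-identityˡ (-ᴹ A) i j)
  s₁ : 1ᴹ *ᴹ (-ᴹ A) +ᴹ 1ᴹ *ᴹ scalar s ≐ K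
  s₁ i j = trans (cong₂ _+_ (*ᴹ-identityˡ (-ᴹ A) i j) (*ᴹ-identityˡ (scalar s) i j)) (ℤP.+-comm (- A i j) (scalar s i j))
  p₂ : scalar s *ᴹ 1ᴹ +ᴹ (-ᴹ A) *ᴹ (-ᴹ 1ᴹ) ≐ K′
  p₂ i j = cong₂ _+_ (*ᴹ-identityʳ (scalar s) i j) (trans (*ᴹ-negʳ (-ᴹ A) 1ᴹ i j) (cong -_ (*ᴹ-identityʳ (-ᴹ A) i j)))
  q₂ : scalar s *ᴹ 0ᴹ +ᴹ (-ᴹ A) *ᴹ 1ᴹ ≐ -ᴹ A
  q₂ i j = trans (cong₂ _+_ (*ᴹ-zeroʳ (scalar s) i j) (*ᴹ-identityʳ (-ᴹ A) i j)) (ℤP.+-identityˡ _)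
  r₂ : K *ᴹ 1ᴹ +ᴹ K *ᴹ (-ᴹ 1ᴹ) ≐ 0ᴹ
  r₂ i j = trans (cong₂ _+_ (*ᴹ-identityʳ K i j) (trans (*ᴹ-negʳ K 1ᴹ i j) (cong -_ (*ᴹ-identityʳ K i j))))
                 (ℤP.+-inverseʳ (K i j))
  s₂ : K *ᴹ 0ᴹ +ᴹ K *ᴹ 1ᴹ ≐ K
  s₂ i j = trans (cong₂ _+_ (*ᴹ-zeroʳ K i j) (*ᴹ-identityʳ K i j)) (ℤP.+-identityˡ _)
  L*M : L *ᴹ M ≐ M′
  L*M i j = trans (block-*ᴹ 1ᴹ 0ᴹ 1ᴹ 1ᴹ (scalar s) (-ᴹ A) (-ᴹ A) (scalar s) i j) (block-cong p₁ q₁ r₁ s₁ i j)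
  M′*R : M′ *ᴹ R ≐ block K′ (-ᴹ A) 0ᴹ K
  M′*R i j = trans (block-*ᴹ (scalar s) (-ᴹ A) K K 1ᴹ 0ᴹ (-ᴹ 1ᴹ) 1ᴹ i j) (block-cong p₂ q₂ r₂ s₂ i j)


-- The symmetric lift of a regular graph

listSum : List ℤ → ℤ
listSum = List.foldr _+_ (+ 0)

sum-lookup : {X : Set} (xs : List X) (h : X → ℤ) → sum (λ k → h (lookup xs k)) ≡ listSum (List.map h xs)
sum-lookup []       h = refl
sum-lookup (x ∷ xs) h = cong (_+_ (h x)) (sum-lookup xs h)

listSum-++ : (xs ys : List ℤ) → listSum (xs List.++ ys) ≡ listSum xs + listSum ys
listSum-++ []       ys = sym (ℤP.+-identityˡ _)
listSum-++ (x ∷ xs) ys = trans (cong (_+_ x) (listSum-++ xs ys)) (sym (ℤP.+-assoc x _ _))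

listSum-filterᵇ : {X : Set} (P : X → Bool) (h : X → ℤ) (xs : List X) →
                  listSum (List.map h (filterᵇ P xs)) ≡ listSum (List.map (λ x → boolToℤ (P x) * h x) xs)
listSum-filterᵇ P h []       = refl
listSum-filterᵇ P h (x ∷ xs) with P x
... | true  = cong₂ _+_ (sym (ℤP.*-identityˡ (h x))) (listSum-filterᵇ P h xs)
... | false = trans (listSum-filterᵇ P h xs) (sym (ℤP.+-identityˡ _))

listSum-cartesianProduct : {X Y : Set} (h : X × Y → ℤ) (xs : List X) (ys : List Y) →
  listSum (List.map h (cartesianProduct xs ys)) ≡ listSum (List.map (λ x → listSum (List.map (λ y → h (x , y)) ys)) xs)
listSum-cartesianProduct h []       ys = refl
listSum-cartesianProduct h (x ∷ xs) ys = begin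
  listSum (List.map h (List.map (x ,_) ys List.++ cartesianProduct xs ys))
    ≡⟨ cong listSum (ListP.map-++ h (List.map (x ,_) ys) _) ⟩
  listSum (List.map h (List.map (x ,_) ys) List.++ List.map h (cartesianProduct xs ys))
    ≡⟨ listSum-++ (List.map h (List.map (x ,_) ys)) _ ⟩
  listSum (List.map h (List.map (x ,_) ys)) + listSum (List.map h (cartesianProduct xs ys))
    ≡⟨ cong₂ _+_ (cong listSum (sym (ListP.map-∘ ys))) (listSum-cartesianProduct h xs ys) ⟩
  listSum (List.map (λ y → h (x , y)) ys) + listSum (List.map (λ x → listSum (List.map (λ y → h (x , y)) ys)) xs)  ∎
  where open ≡-Reasoning

listSum-allFin : (g : Fin n → ℤ) → listSum (List.map g (allFin n)) ≡ sum g
listSum-allFin g = trans (cong listSum (ListP.map-tabulate (λ j → j) g)) (foldr-tabulate g)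

lookup-injective : {X : Set} {xs : List X} → Unique xs → ∀ {k l} → lookup xs k ≡ lookup xs l → k ≡ l
lookup-injective (_  ∷ _) {zero}  {zero}  _  = refl
lookup-injective (x∉ ∷ _) {zero}  {suc l} eq = ⊥-elim (All.lookup x∉ (∈-lookup l) eq)
lookup-injective (x∉ ∷ _) {suc k} {zero}  eq = ⊥-elim (All.lookup x∉ (∈-lookup k) (sym eq))
lookup-injective (_  ∷ u) {suc k} {suc l} eq = cong suc (lookup-injective u eq)

sum²-δˡ-δˡ : (g : Matrix n) (u w : Fin n) → sum (λ a → sum (λ b → g a b * (δ u a * δ w a))) ≡ δ u w * sum (g u)
sum²-δˡ-δˡ g u w = begin
  sum (λ a → sum (λ b → g a b * (δ u a * δ w a)))
    ≡⟨ sum-cong-≗ (λ a → *-distribʳ-sum (δ u a * δ w a) (g a)) ⟨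
  sum (λ a → sum (g a) * (δ u a * δ w a))          ≡⟨ sum-cong-≗ (λ a → regroup (sum (g a)) (δ u a) (δ w a)) ⟩
  sum (λ a → δ u a * (δ w a * sum (g a)))          ≡⟨ sum-δˡ u (λ a → δ w a * sum (g a)) ⟩
  δ w u * sum (g u)                                ≡⟨ cong (_* sum (g u)) (δ-sym w u) ⟩
  δ u w * sum (g u)                                ∎
  where
  open ≡-Reasoning
  regroup : ∀ x y z → x * (y * z) ≡ y * (z * x)
  regroup = solve-∀

sum²-δˡ-δʳ : (g : Matrix n) (u v : Fin n) → sum (λ a → sum (λ b → g a b * (δ u a * δ v b))) ≡ g u v
sum²-δˡ-δʳ g u v = begin
  sum (λ a → sum (λ b → g a b * (δ u a * δ v b)))
    ≡⟨ sum-cong-≗ (λ a → sum-cong-≗ (λ b → regroup (g a b) (δ u a) (δ v b))) ⟩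
  sum (λ a → sum (λ b → δ u a * (δ v b * g a b)))
    ≡⟨ sum-cong-≗ (λ a → *-distribˡ-sum (δ u a) (λ b → δ v b * g a b)) ⟨
  sum (λ a → δ u a * sum (λ b → δ v b * g a b))    ≡⟨ sum-cong-≗ (λ a → cong (δ u a *_) (sum-δˡ v (g a))) ⟩
  sum (λ a → δ u a * g a v)                        ≡⟨ sum-δˡ u (λ a → g a v) ⟩
  g u v                                            ∎
  where
  open ≡-Reasoning
  regroup : ∀ x y z → x * (y * z) ≡ y * (z * x)
  regroup = solve-∀

sum²-δʳ-δˡ : (g : Matrix n) (u v : Fin n) → sum (λ a → sum (λ b → g a b * (δ v b * δ u a))) ≡ g u v
sum²-δʳ-δˡ g u v = trans (∑-comm (λ a b → g a b * (δ v b * δ u a))) (sum²-δˡ-δʳ (g ᵀ) v u)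

sum²-δʳ-δʳ : (g : Matrix n) (v w : Fin n) → sum (λ a → sum (λ b → g a b * (δ v b * δ w b))) ≡ δ v w * sum (λ a → g a v)
sum²-δʳ-δʳ g v w = trans (∑-comm (λ a b → g a b * (δ v b * δ w b))) (sum²-δˡ-δˡ (g ᵀ) v w)

line-graph-entry : ∀ e₁ e₂ →
                   boolToℤ (not (e₁ ∧ e₂) ∧ (e₁ ∨ e₂)) ≡ boolToℤ e₁ + boolToℤ e₂ - + 2 * boolToℤ (e₁ ∧ e₂)
line-graph-entry true  true  = refl
line-graph-entry true  false = refl
line-graph-entry false true  = refl
line-graph-entry false false = refl

Symmetric : Graph n → Set
Symmetric G = ∀ u v → G u v ≡ G v u

Regular : ℕ → Graph n → Set
Regular d G = ∀ u → sum (adjMatrix G u) ≡ + d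

module Lift (G : Graph n) where
  private
    A = adjMatrix G

  edge : Fin (HLsize G) → Fin n × Fin n
  edge = lookup (HLVertices G)

  sum-edges : (h : Fin n × Fin n → ℤ) → sum (h ∘ edge) ≡ sum (λ a → sum (λ b → A a b * h (a , b)))
  sum-edges h = begin
    sum (h ∘ edge)
      ≡⟨ sum-lookup (HLVertices G) h ⟩
    listSum (List.map h (HLVertices G))
      ≡⟨ listSum-filterᵇ _ h (cartesianProduct (allFin n) (allFin n)) ⟩
    listSum (List.map (λ e → A (proj₁ e) (proj₂ e) * h e) (cartesianProduct (allFin n) (allFin n)))
      ≡⟨ listSum-cartesianProduct (λ e → A (proj₁ e) (proj₂ e) * h e) (allFin n) (allFin n) ⟩
    listSum (List.map (λ a → listSum (List.map (λ b → A a b * h (a , b)) (allFin n))) (allFin n))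
      ≡⟨ cong listSum (ListP.map-cong (λ a → listSum-allFin (λ b → A a b * h (a , b))) (allFin n)) ⟩
    listSum (List.map (λ a → sum (λ b → A a b * h (a , b))) (allFin n))
      ≡⟨ listSum-allFin (λ a → sum (λ b → A a b * h (a , b))) ⟩
    sum (λ a → sum (λ b → A a b * h (a , b)))  ∎
    where open ≡-Reasoning

  edge-injective : ∀ {k l} → edge k ≡ edge l → k ≡ l
  edge-injective = lookup-injective (Unique.filter⁺ _ (Unique.cartesianProduct⁺ (Unique.allFin⁺ n) (Unique.allFin⁺ n)))

  ==ᶠ-edge : ∀ k l → (k ==ᶠ l) ≡ (proj₁ (edge k) ==ᶠ proj₁ (edge l)) ∧ (proj₂ (edge k) ==ᶠ proj₂ (edge l))
  ==ᶠ-edge k l with k Fin.≟ l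
  ... | yes refl = trans (==ᶠ-refl k) (sym (cong₂ _∧_ (==ᶠ-refl (proj₁ (edge k))) (==ᶠ-refl (proj₂ (edge k)))))
  ... | no k≢l with proj₁ (edge k) ==ᶠ proj₁ (edge l) in e₁ | proj₂ (edge k) ==ᶠ proj₂ (edge l) in e₂
  ...   | true  | true  = ⊥-elim (k≢l (edge-injective (cong₂ _,_ (==ᶠ⇒≡ e₁) (==ᶠ⇒≡ e₂))))
  ...   | true  | false = ≢⇒==ᶠ-false k≢l
  ...   | false | _     = ≢⇒==ᶠ-false k≢l

  -- Rows are indexed by V′ ⊔ V″, columns by the edges u′v″ of the double cover.
  incidence : Mat (n ℕ.+ n) (HLsize G)
  incidence = (λ u k → δ u (proj₁ (edge k))) ++ (λ v k → δ v (proj₂ (edge k)))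

  incidence-↑ˡ : ∀ u k → incidence (u ↑ˡ n) k ≡ δ u (proj₁ (edge k))
  incidence-↑ˡ u k = cong-app (lookup-++ˡ (λ u k → δ u (proj₁ (edge k))) (λ v k → δ v (proj₂ (edge k))) u) k

  incidence-↑ʳ : ∀ v k → incidence (n ↑ʳ v) k ≡ δ v (proj₂ (edge k))
  incidence-↑ʳ v k = cong-app (lookup-++ʳ (λ u k → δ u (proj₁ (edge k))) (λ v k → δ v (proj₂ (edge k))) v) k

  incidenceᵀ*incidence : ∀ k l → (incidence ᵀ *ᴹ incidence) k l ≡
                         δ (proj₁ (edge k)) (proj₁ (edge l)) + δ (proj₂ (edge k)) (proj₂ (edge l))
  incidenceᵀ*incidence k l = trans (sum-split n (λ i → incidence i k * incidence i l)) (cong₂ _+_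
    (trans (sum-cong-≗ (λ u → cong₂ _*_ (incidence-↑ˡ u k) (incidence-↑ˡ u l)))
           (sum-δʳ (proj₁ (edge k)) (λ u → δ u (proj₁ (edge l)))))
    (trans (sum-cong-≗ (λ v → cong₂ _*_ (incidence-↑ʳ v k) (incidence-↑ʳ v l)))
           (sum-δʳ (proj₂ (edge k)) (λ v → δ v (proj₂ (edge l))))))

  adjMatrix-HL2 : ∀ k l → adjMatrix (HL2 G) k l ≡ (incidence ᵀ *ᴹ incidence) k l - + 2 * δ k l
  adjMatrix-HL2 k l = trans (line-graph-entry (proj₁ (edge k) ==ᶠ proj₁ (edge l)) (proj₂ (edge k) ==ᶠ proj₂ (edge l)))
    (cong₂ (λ x c → x - + 2 * boolToℤ c) (sym (incidenceᵀ*incidence k l)) (sym (==ᶠ-edge k l)))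

  charMatrix-HL2 : ∀ x → charMatrix x (adjMatrix (HL2 G)) ≐ charMatrix (x + + 2) (incidence ᵀ *ᴹ incidence)
  charMatrix-HL2 x k l = trans (cong (λ a → x * δ k l - a) (adjMatrix-HL2 k l)) (shift x (δ k l) _)
    where
    shift : ∀ x d y → x * d - (y - + 2 * d) ≡ (x + + 2) * d - y
    shift = solve-∀

  incidence*incidenceᵀ : ∀ {d} → Symmetric G → Regular d G →
                         incidence *ᴹ incidence ᵀ ≐ block (scalar (+ d)) A A (scalar (+ d))
  incidence*incidenceᵀ {d} G-sym G-reg = ≐-block
    (λ u w → trans (rows (λ e → δ u (proj₁ e)) (λ e → δ w (proj₁ e)) (incidence-↑ˡ u) (incidence-↑ˡ w))
             (trans (sum²-δˡ-δˡ A u w) (trans (cong (δ u w *_) (G-reg u)) (ℤP.*-comm (δ u w) (+ d)))))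
    (λ u v → trans (rows (λ e → δ u (proj₁ e)) (λ e → δ v (proj₂ e)) (incidence-↑ˡ u) (incidence-↑ʳ v))
             (sum²-δˡ-δʳ A u v))
    (λ v u → trans (rows (λ e → δ v (proj₂ e)) (λ e → δ u (proj₁ e)) (incidence-↑ʳ v) (incidence-↑ˡ u))
             (trans (sum²-δʳ-δˡ A u v) (cong boolToℤ (G-sym u v))))
    (λ v w → trans (rows (λ e → δ v (proj₂ e)) (λ e → δ w (proj₂ e)) (incidence-↑ʳ v) (incidence-↑ʳ w))
             (trans (sum²-δʳ-δʳ A v w) (trans (cong (δ v w *_) in-degree) (ℤP.*-comm (δ v w) (+ d)))))
    where
    rows : ∀ {i j} (f g : Fin n × Fin n → ℤ) →
           (∀ k → incidence i k ≡ f (edge k)) → (∀ k → incidence j k ≡ g (edge k)) →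
           (incidence *ᴹ incidence ᵀ) i j ≡ sum (λ a → sum (λ b → A a b * (f (a , b) * g (a , b))))
    rows f g fᵢ gⱼ = trans (sum-cong-≗ (λ k → cong₂ _*_ (fᵢ k) (gⱼ k))) (sum-edges (λ e → f e * g e))
    in-degree : ∀ {v} → sum (λ a → A a v) ≡ + d
    in-degree {v} = trans (sum-cong-≗ (λ a → cong boolToℤ (G-sym a v))) (G-reg v)

  HLsize-regular : ∀ {d} → Regular d G → HLsize G ≡ n ℕ.* d
  HLsize-regular {d} G-reg = ℤP.+-injective (begin
    + HLsize G                                  ≡⟨ cong +_ (ℕP.*-identityʳ (HLsize G)) ⟨
    + (HLsize G ℕ.* 1)                          ≡⟨ sum-const (HLsize G) 1 ⟨
    sum (λ (_ : Fin (HLsize G)) → + 1)          ≡⟨ sum-edges (λ _ → + 1) ⟩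
    sum (λ a → sum (λ b → A a b * + 1))
      ≡⟨ sum-cong-≗ (λ a → trans (sum-cong-≗ (λ b → ℤP.*-identityʳ (A a b))) (G-reg a)) ⟩
    sum (λ (_ : Fin n) → + d)                   ≡⟨ sum-const n d ⟩
    + (n ℕ.* d)                                 ∎)
    where open ≡-Reasoning

charPoly-HL2 : (G : Graph n) {d e : ℕ} → Symmetric G → Regular d G → HLsize G ≡ (n ℕ.+ n) ℕ.+ e → ∀ x →
               charPoly (adjMatrix (HL2 G)) x ≡
               (x + + 2) ^ℤ e * charPoly (adjMatrix G) (x - + d + + 2) * ((- + 1) ^ℤ n * charPoly (adjMatrix G) (- (x - + d + + 2)))
charPoly-HL2 {n} G {d} {e} G-sym G-reg size x = begin
  charPoly (adjMatrix (HL2 G)) x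
    ≡⟨ charPoly≡det-charMatrix (adjMatrix (HL2 G)) x ⟩
  det (HLsize G) (charMatrix x (adjMatrix (HL2 G)))                ≡⟨ det-cong (HLsize G) (charMatrix-HL2 x) ⟩
  det (HLsize G) (charMatrix t (incidence ᵀ *ᴹ incidence))         ≡⟨ sylvester (n ℕ.+ n) e size incidence t ⟩
  t ^ℤ e * det (n ℕ.+ n) (charMatrix t (incidence *ᴹ incidence ᵀ)) ≡⟨ cong (t ^ℤ e *_) (det-cong (n ℕ.+ n) bipartite) ⟩
  t ^ℤ e * det (n ℕ.+ n) (block (scalar s) (-ᴹ A) (-ᴹ A) (scalar s)) ≡⟨ cong (t ^ℤ e *_) (det-block-scalar-neg n s A) ⟩
  t ^ℤ e * (det n (charMatrix s (-ᴹ A)) * det n (charMatrix s A))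
    ≡⟨ cong (λ y → t ^ℤ e * (y * det n (charMatrix s A))) negated ⟩
  t ^ℤ e * ((- + 1) ^ℤ n * det n (charMatrix (- s) A) * det n (charMatrix s A))
    ≡⟨ cong₂ (λ y z → t ^ℤ e * ((- + 1) ^ℤ n * y * z)) (charPoly≡det-charMatrix A (- s)) (charPoly≡det-charMatrix A s) ⟨
  t ^ℤ e * ((- + 1) ^ℤ n * charPoly A (- s) * charPoly A s)
    ≡⟨ regroup (t ^ℤ e) ((- + 1) ^ℤ n) (charPoly A (- s)) (charPoly A s) ⟩
  t ^ℤ e * charPoly A s * ((- + 1) ^ℤ n * charPoly A (- s))
    ≡⟨ cong (λ y → t ^ℤ e * charPoly A y * ((- + 1) ^ℤ n * charPoly A (- y))) s≡ ⟩
  t ^ℤ e * charPoly A (x - + d + + 2) * ((- + 1) ^ℤ n * charPoly A (- (x - + d + + 2)))  ∎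
  where
  open ≡-Reasoning
  open Lift G
  A = adjMatrix G
  t = x + + 2
  s = t - + d
  s≡ : s ≡ x - + d + + 2
  s≡ = shuffle x (+ d)
    where
    shuffle : ∀ x d → x + + 2 - d ≡ x - d + + 2
    shuffle = solve-∀
  scalar-shift : charMatrix t (scalar {n} (+ d)) ≐ scalar s
  scalar-shift i j = distrib t (+ d) (δ i j)
    where
    distrib : ∀ t d δ → t * δ - d * δ ≡ (t - d) * δ
    distrib = solve-∀
  bipartite : charMatrix t (incidence *ᴹ incidence ᵀ) ≐ block (scalar s) (-ᴹ A) (-ᴹ A) (scalar s)
  bipartite i j = trans (charMatrix-block {n} t (incidence*incidenceᵀ G-sym G-reg) i j)
                        (block-cong scalar-shift (λ _ _ → refl) (λ _ _ → refl) scalar-shift i j)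
  negated : det n (charMatrix s (-ᴹ A)) ≡ (- + 1) ^ℤ n * det n (charMatrix (- s) A)
  negated = trans (det-cong n (λ i j → flip s (δ i j) (A i j))) (det-neg n (charMatrix (- s) A))
    where
    flip : ∀ s δ a → s * δ - - a ≡ - ((- s) * δ - a)
    flip = solve-∀
  regroup : ∀ a b c d → a * (b * c * d) ≡ a * d * (b * c)
  regroup = solve-∀


-- Quadratic residues modulo a prime

T-not : ∀ {b} → T (not b) → ¬ T b
T-not {true} ()

¬T⇒T-not : ∀ {b} → ¬ T b → T (not b)
¬T⇒T-not {false} _  = tt
¬T⇒T-not {true}  ¬t = ¬t tt

T-injective : ∀ {a b} → (T a → T b) → (T b → T a) → a ≡ b
T-injective {false} {false} _ _ = refl
T-injective {false} {true}  _ g = ⊥-elim (g tt)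
T-injective {true}  {false} f _ = ⊥-elim (f tt)
T-injective {true}  {true}  _ _ = refl

boolToℤ-T : ∀ {b} → T b → boolToℤ b ≡ + 1
boolToℤ-T {true} _ = refl

boolToℤ-¬T : ∀ {b} → ¬ T b → boolToℤ b ≡ + 0
boolToℤ-¬T {false} _ = refl
boolToℤ-¬T {true}  ¬t = ⊥-elim (¬t tt)

module Modular (p : ℕ) (p-prime : Prime p) where

  instance
    p≢0 : ℕ.NonZero p
    p≢0 = prime⇒nonZero p-prime

  -- A record rather than an abbreviation of + p ∣ x - y, so that x and y can be inferred.
  infix 4 _≋_
  record _≋_ (x y : ℤ) : Set where
    constructor mk≋
    field divisible : + p ∣ x - y

  ≡⇒≋ : ∀ {x y} → x ≡ y → x ≋ y
  ≡⇒≋ {x} refl = mk≋ (divides (+ 0) (ℤP.+-inverseʳ x))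

  ≋-sym : ∀ {x y} → x ≋ y → y ≋ x
  ≋-sym {x} {y} (mk≋ x≋y) = mk≋ (subst (+ p ∣_) (negate x y) (∣m⇒∣-m x≋y))
    where
    negate : ∀ x y → - (x - y) ≡ y - x
    negate = solve-∀

  ≋-trans : ∀ {x y z} → x ≋ y → y ≋ z → x ≋ z
  ≋-trans {x} {y} {z} (mk≋ x≋y) (mk≋ y≋z) = mk≋ (subst (+ p ∣_) (telescope x y z) (∣m∣n⇒∣m+n x≋y y≋z))
    where
    telescope : ∀ x y z → (x - y) + (y - z) ≡ x - z
    telescope = solve-∀

  +-cong : ∀ {x y u v} → x ≋ y → u ≋ v → x + u ≋ y + v
  +-cong {x} {y} {u} {v} (mk≋ x≋y) (mk≋ u≋v) = mk≋ (subst (+ p ∣_) (regroup x y u v) (∣m∣n⇒∣m+n x≋y u≋v))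
    where
    regroup : ∀ x y u v → (x - y) + (u - v) ≡ (x + u) - (y + v)
    regroup = solve-∀

  neg-cong : ∀ {x y} → x ≋ y → - x ≋ - y
  neg-cong {x} {y} (mk≋ x≋y) = mk≋ (subst (+ p ∣_) (negate x y) (∣m⇒∣-m x≋y))
    where
    negate : ∀ x y → - (x - y) ≡ - x - - y
    negate = solve-∀

  *-cong : ∀ {x y u v} → x ≋ y → u ≋ v → x * u ≋ y * v
  *-cong {x} {y} {u} {v} (mk≋ x≋y) (mk≋ u≋v) =
    mk≋ (subst (+ p ∣_) (regroup x y u v) (∣m∣n⇒∣m+n (∣n⇒∣m*n x u≋v) (∣m⇒∣m*n v x≋y)))
    where
    regroup : ∀ x y u v → x * (u - v) + (x - y) * v ≡ x * u - y * v
    regroup = solve-∀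

  +-congˡ : ∀ x {u v} → u ≋ v → x + u ≋ x + v
  +-congˡ x u≋v = +-cong (≡⇒≋ {x} refl) u≋v

  +-congʳ : ∀ {x y} u → x ≋ y → x + u ≋ y + u
  +-congʳ u x≋y = +-cong x≋y (≡⇒≋ {u} refl)

  *-congˡ : ∀ x {u v} → u ≋ v → x * u ≋ x * v
  *-congˡ x u≋v = *-cong (≡⇒≋ {x} refl) u≋v

  ≋⇒-≋0 : ∀ {x y} → x ≋ y → x - y ≋ + 0
  ≋⇒-≋0 {x} {y} x≋y = ≋-trans (+-congʳ (- y) x≋y) (≡⇒≋ (ℤP.+-inverseʳ y))

  -≋0⇒≋ : ∀ {x y} → x - y ≋ + 0 → x ≋ y
  -≋0⇒≋ {x} {y} x-y≋0 = ≋-trans (≡⇒≋ (shift x y)) (≋-trans (+-congʳ y x-y≋0) (≡⇒≋ (ℤP.+-identityˡ y)))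
    where
    shift : ∀ x y → x ≡ (x - y) + y
    shift = solve-∀

  p≋0 : + p ≋ + 0
  p≋0 = mk≋ (divides (+ 1) (trans (ℤP.+-identityʳ (+ p)) (sym (ℤP.*-identityˡ (+ p)))))

  ≋0⇒∣ : ∀ {x} → x ≋ + 0 → p ℕ∣.∣ ℤ.∣ x ∣
  ≋0⇒∣ {x} (mk≋ x≋0) = subst (λ y → p ℕ∣.∣ ℤ.∣ y ∣) (ℤP.+-identityʳ x) (∣⇒∣ᵤ x≋0)

  ∣⇒≋0 : ∀ {x} → p ℕ∣.∣ ℤ.∣ x ∣ → x ≋ + 0
  ∣⇒≋0 {x} p∣x = mk≋ (subst (+ p ∣_) (sym (ℤP.+-identityʳ x)) (∣ᵤ⇒∣ p∣x))

  euclid : ∀ x y → x * y ≋ + 0 → x ≋ + 0 ⊎ y ≋ + 0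
  euclid x y xy≋0 = Sum.map (∣⇒≋0 {x}) (∣⇒≋0 {y})
    (euclidsLemma ℤ.∣ x ∣ ℤ.∣ y ∣ p-prime (subst (p ℕ∣.∣_) (ℤP.abs-* x y) (≋0⇒∣ xy≋0)))

  square-roots : ∀ u v → u * u ≋ v * v → u ≋ v ⊎ u ≋ - v
  square-roots u v u²≋v² = Sum.map (-≋0⇒≋ {u} {v})
    (λ u+v≋0 → -≋0⇒≋ {u} { - v} (≋-trans (≡⇒≋ (cong (_+_ u) (ℤP.neg-involutive v))) u+v≋0))
    (euclid (u - v) (u + v) (≋-trans (≡⇒≋ (factor u v)) (≋⇒-≋0 {u * u} {v * v} u²≋v²)))
    where
    factor : ∀ u v → (u - v) * (u + v) ≡ u * u - v * v
    factor = solve-∀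

  1≉0 : ¬ (+ 1 ≋ + 0)
  1≉0 1≋0 = ¬prime[1] (subst Prime (ℕ∣.∣1⇒≡1 (≋0⇒∣ 1≋0)) p-prime)

  private
    too-close : ∀ {m n} → m ℕ.< n → n ℕ.< p → ¬ (+ n ≋ + m)
    too-close {m} {n} m<n n<p (mk≋ n≋m) =
      ℕP.<⇒≱ (ℕP.≤-<-trans (ℕP.m∸n≤m n m) n<p) (ℕ∣.∣⇒≤ {{ℕ.>-nonZero (ℕP.m<n⇒0<n∸m m<n)}} p∣n∸m)
      where
      difference : + n - + m ≡ + (n ℕ.∸ m)
      difference = trans (ℤP.m-n≡m⊖n n m) (ℤP.⊖-≥ (ℕP.<⇒≤ m<n))
      p∣n∸m : p ℕ∣.∣ n ℕ.∸ m
      p∣n∸m = subst (λ z → p ℕ∣.∣ ℤ.∣ z ∣) difference (∣⇒∣ᵤ n≋m)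

  small-injective : ∀ {m n} → m ℕ.< p → n ℕ.< p → + m ≋ + n → m ≡ n
  small-injective {m} {n} m<p n<p m≋n with ℕP.<-cmp m n
  ... | tri≈ _ m≡n _ = m≡n
  ... | tri< m<n _ _ = ⊥-elim (too-close m<n n<p (≋-sym m≋n))
  ... | tri> _ _ n<m = ⊥-elim (too-close n<m m<p m≋n)

  %-≋ : ∀ n → + (n % p) ≋ + n
  %-≋ n = mk≋ (divides (- + (n / p)) (begin
    + (n % p) - + n                                   ≡⟨ cong (λ k → + (n % p) - + k) (m≡m%n+[m/n]*n n p) ⟩
    + (n % p) - + (n % p ℕ.+ n / p ℕ.* p)
      ≡⟨ cong (λ k → + (n % p) - k) (trans (ℤP.pos-+ (n % p) _) (cong (_+_ (+ (n % p))) (ℤP.pos-* (n / p) p))) ⟩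
    + (n % p) - (+ (n % p) + + (n / p) * + p)         ≡⟨ cancel (+ (n % p)) (+ (n / p)) (+ p) ⟩
    - + (n / p) * + p                                 ∎))
    where
    open ≡-Reasoning
    cancel : ∀ r q d → r - (r + q * d) ≡ - q * d
    cancel = solve-∀

  %-≡⇒≋ : ∀ {m n} → m % p ≡ n % p → + m ≋ + n
  %-≡⇒≋ {m} {n} eq = ≋-trans (≋-sym (%-≋ m)) (≋-trans (≡⇒≋ (cong +_ eq)) (%-≋ n))

  ≋⇒%-≡ : ∀ {m n} → + m ≋ + n → m % p ≡ n % p
  ≋⇒%-≡ {m} {n} m≋n = small-injective (m%n<n m p) (m%n<n n p) (≋-trans (%-≋ m) (≋-trans m≋n (≋-sym (%-≋ n))))

  ⟦_⟧ : Fin p → ℤ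
  ⟦ a ⟧ = + toℕ a

  ⟦⟧-injective : ∀ {a b} → ⟦ a ⟧ ≋ ⟦ b ⟧ → a ≡ b
  ⟦⟧-injective {a} {b} a≋b = FinP.toℕ-injective (small-injective (FinP.toℕ<n a) (FinP.toℕ<n b) a≋b)

  residue : ℤ → Fin p
  residue z = Fin.fromℕ< (n%ℕd<d z p)

  residue-≋ : ∀ z → ⟦ residue z ⟧ ≋ z
  residue-≋ z = mk≋ (divides (- (z /ℕ p)) (begin
    ⟦ residue z ⟧ - z                                 ≡⟨ cong (λ k → + k - z) (FinP.toℕ-fromℕ< (n%ℕd<d z p)) ⟩
    + (z %ℕ p) - z                                    ≡⟨ cong (λ w → + (z %ℕ p) - w) (a≡a%ℕn+[a/ℕn]*n z p) ⟩
    + (z %ℕ p) - (+ (z %ℕ p) + (z /ℕ p) * + p)        ≡⟨ cancel (+ (z %ℕ p)) (z /ℕ p) (+ p) ⟩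
    - (z /ℕ p) * + p                                  ∎))
    where
    open ≡-Reasoning
    cancel : ∀ r q d → r - (r + q * d) ≡ - q * d
    cancel = solve-∀

  residue-unique : ∀ {a z} → ⟦ a ⟧ ≋ z → residue z ≡ a
  residue-unique {a} {z} a≋z = ⟦⟧-injective (≋-trans (residue-≋ z) (≋-sym a≋z))

  IsNonzeroSquare : ℤ → Set
  IsNonzeroSquare z = ¬ (z ≋ + 0) × ∃ λ y → y * y ≋ z

  IsNonzeroSquare-resp : ∀ {x z} → x ≋ z → IsNonzeroSquare x → IsNonzeroSquare z
  IsNonzeroSquare-resp x≋z (x≉0 , y , y²≋x) = (λ z≋0 → x≉0 (≋-trans x≋z z≋0)) , y , ≋-trans y²≋x x≋z

  private
    %≡0⇒≋0 : ∀ n → T (n % p ℕ.≡ᵇ 0) → + n ≋ + 0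
    %≡0⇒≋0 n t = ≋-trans (≋-sym (%-≋ n)) (≡⇒≋ (cong +_ (ℕP.≡ᵇ⇒≡ (n % p) 0 t)))

    ≋0⇒%≡0 : ∀ n → + n ≋ + 0 → T (n % p ℕ.≡ᵇ 0)
    ≋0⇒%≡0 n n≋0 = ℕP.≡⇒≡ᵇ (n % p) 0 (small-injective (m%n<n n p) (ℕ.>-nonZero⁻¹ p) (≋-trans (%-≋ n) n≋0))

  isNonzeroQR-sound : ∀ n → T (isNonzeroQR p n) → IsNonzeroSquare (+ n)
  isNonzeroQR-sound n qr = n≉0 , + y , y²≋n
    where
    conjuncts = Equivalence.to T-∧ qr
    n≉0 : ¬ (+ n ≋ + 0)
    n≉0 n≋0 = T-not (proj₁ conjuncts) (≋0⇒%≡0 n n≋0)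
    root = applyUpTo⁻ (λ x → x) (any⁻ _ (upTo p) (proj₂ conjuncts))
    y = proj₁ root
    y²≋n : + y * + y ≋ + n
    y²≋n = ≋-trans (≡⇒≋ (sym (ℤP.pos-* y y))) (%-≡⇒≋ (ℕP.≡ᵇ⇒≡ _ _ (proj₂ (proj₂ root))))

  isNonzeroQR-complete : ∀ n → IsNonzeroSquare (+ n) → T (isNonzeroQR p n)
  isNonzeroQR-complete n (n≉0 , y , y²≋n) =
    Equivalence.from T-∧ ( ¬T⇒T-not (n≉0 ∘ %≡0⇒≋0 n)
                         , any⁺ _ (applyUpTo⁺ (λ x → x) (ℕP.≡⇒≡ᵇ _ _ r²≡n) (FinP.toℕ<n (residue y))))
    where
    r = toℕ (residue y)
    r²≡n : (r ℕ.* r) % p ≡ n % p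
    r²≡n = ≋⇒%-≡ (≋-trans (≡⇒≋ (ℤP.pos-* r r)) (≋-trans (*-cong (residue-≋ y) (residue-≋ y)) y²≋n))

  isNonzeroQR-cong : ∀ {m n} → + m ≋ + n → isNonzeroQR p m ≡ isNonzeroQR p n
  isNonzeroQR-cong {m} {n} m≋n = T-injective
    (isNonzeroQR-complete n ∘ IsNonzeroSquare-resp m≋n ∘ isNonzeroQR-sound m)
    (isNonzeroQR-complete m ∘ IsNonzeroSquare-resp (≋-sym m≋n) ∘ isNonzeroQR-sound n)

module QuadraticResidues (p : ℕ) (p-prime : Prime p) (2<p : 2 ℕ.< p) where
  open Modular p p-prime public

  2≉0 : ¬ (+ 2 ≋ + 0)
  2≉0 2≋0 = ℕP.<⇒≱ 2<p (ℕ∣.∣⇒≤ (≋0⇒∣ 2≋0))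

  qrIndicator : Fin p → ℤ
  qrIndicator a = boolToℤ (isNonzeroQR p (toℕ a))

  0ₚ 1ₚ -1ₚ : Fin p
  0ₚ  = Fin.fromℕ< (ℕ.>-nonZero⁻¹ p)
  1ₚ  = residue (+ 1)
  -1ₚ = residue (- + 1)

  0ₚ-≋ : ⟦ 0ₚ ⟧ ≋ + 0
  0ₚ-≋ = ≡⇒≋ (cong +_ (FinP.toℕ-fromℕ< (ℕ.>-nonZero⁻¹ p)))

  ≋0⇒≡0ₚ : ∀ {a} → ⟦ a ⟧ ≋ + 0 → a ≡ 0ₚ
  ≋0⇒≡0ₚ a≋0 = ⟦⟧-injective (≋-trans a≋0 (≋-sym 0ₚ-≋))

  qrIndicator-0ₚ : qrIndicator 0ₚ ≡ + 0
  qrIndicator-0ₚ = boolToℤ-¬T (λ t → proj₁ (isNonzeroQR-sound _ t) 0ₚ-≋)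

  square : Fin p → Fin p
  square y = residue (⟦ y ⟧ * ⟦ y ⟧)

  square-≋ : ∀ y {a} → square y ≡ a → ⟦ y ⟧ * ⟦ y ⟧ ≋ ⟦ a ⟧
  square-≋ y refl = ≋-sym (residue-≋ (⟦ y ⟧ * ⟦ y ⟧))

  private
    fibre-0ₚ : sum (λ y → δ (square y) 0ₚ) ≡ + 1
    fibre-0ₚ = trans (sum-single _ 0ₚ vanish) (trans (cong (λ b → δ b 0ₚ) (residue-unique 0²≋0)) (δ-refl 0ₚ))
      where
      0²≋0 : ⟦ 0ₚ ⟧ ≋ ⟦ 0ₚ ⟧ * ⟦ 0ₚ ⟧
      0²≋0 = ≋-trans 0ₚ-≋ (≋-sym (*-cong 0ₚ-≋ 0ₚ-≋))
      vanish : ∀ y → y ≢ 0ₚ → δ (square y) 0ₚ ≡ + 0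
      vanish y y≢0 = δ-≢ λ y²≡0 → [ y≢0 ∘ ≋0⇒≡0ₚ , y≢0 ∘ ≋0⇒≡0ₚ ]′
        (euclid ⟦ y ⟧ ⟦ y ⟧ (≋-trans (square-≋ y y²≡0) 0ₚ-≋))

    fibre-nonsquare : ∀ {a} → a ≢ 0ₚ → ¬ T (isNonzeroQR p (toℕ a)) → sum (λ y → δ (square y) a) ≡ + 0
    fibre-nonsquare {a} a≢0 ¬qr = sum-≗0 λ y → δ-≢ λ y²≡a →
      ¬qr (isNonzeroQR-complete (toℕ a) ((a≢0 ∘ ≋0⇒≡0ₚ) , ⟦ y ⟧ , square-≋ y y²≡a))

    fibre-square : ∀ {a} → T (isNonzeroQR p (toℕ a)) → sum (λ y → δ (square y) a) ≡ + 2
    fibre-square {a} qr = fibre-root (isNonzeroQR-sound (toℕ a) qr)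
      where
      fibre-root : IsNonzeroSquare ⟦ a ⟧ → sum (λ y → δ (square y) a) ≡ + 2
      fibre-root (a≉0 , y₀ , y₀²≋a) = begin
        sum (λ y → δ (square y) a)             ≡⟨ sum-pair (λ y → δ (square y) a) r₀≢r₁ vanish ⟩
        δ (square r₀) a + δ (square r₁) a      ≡⟨ cong₂ _+_ (δ-square r₀ r₀²≋y₀²) (δ-square r₁ r₁²≋y₀²) ⟩
        + 2                                    ∎
        where
        open ≡-Reasoning
        neg² : ∀ y → - y * - y ≡ y * y
        neg² = solve-∀
        r₀ r₁ : Fin p
        r₀ = residue y₀
        r₁ = residue (- y₀)
        r₀²≋y₀² : ⟦ r₀ ⟧ * ⟦ r₀ ⟧ ≋ y₀ * y₀
        r₀²≋y₀² = *-cong (residue-≋ y₀) (residue-≋ y₀)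
        r₁²≋y₀² : ⟦ r₁ ⟧ * ⟦ r₁ ⟧ ≋ y₀ * y₀
        r₁²≋y₀² = ≋-trans (*-cong (residue-≋ (- y₀)) (residue-≋ (- y₀))) (≡⇒≋ (neg² y₀))
        δ-square : ∀ r → ⟦ r ⟧ * ⟦ r ⟧ ≋ y₀ * y₀ → δ (square r) a ≡ + 1
        δ-square r r²≋y₀² = trans (cong (λ b → δ b a) (residue-unique (≋-sym (≋-trans r²≋y₀² y₀²≋a)))) (δ-refl a)
        r₀≢r₁ : r₀ ≢ r₁
        r₀≢r₁ r₀≡r₁ = [ 2≉0 , y₀≉0 ]′ (euclid (+ 2) y₀ (≋-trans (≡⇒≋ (twice y₀)) (≋⇒-≋0 y₀≋-y₀)))
          where
          twice : ∀ y → + 2 * y ≡ y - - y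
          twice = solve-∀
          y₀≉0 : ¬ (y₀ ≋ + 0)
          y₀≉0 y₀≋0 = a≉0 (≋-trans (≋-sym y₀²≋a) (*-cong y₀≋0 y₀≋0))
          y₀≋-y₀ : y₀ ≋ - y₀
          y₀≋-y₀ = ≋-trans (≋-sym (residue-≋ y₀)) (≋-trans (≡⇒≋ (cong ⟦_⟧ r₀≡r₁)) (residue-≋ (- y₀)))
        vanish : ∀ y → y ≢ r₀ → y ≢ r₁ → δ (square y) a ≡ + 0
        vanish y y≢r₀ y≢r₁ = δ-≢ λ y²≡a → [ y≢r₀ ∘ sym ∘ residue-unique , y≢r₁ ∘ sym ∘ residue-unique ]′
          (square-roots ⟦ y ⟧ y₀ (≋-trans (square-≋ y y²≡a) (≋-sym y₀²≋a)))

  square-fibre : ∀ a → sum (λ y → δ (square y) a) ≡ δ 0ₚ a + + 2 * qrIndicator a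
  square-fibre a with a Fin.≟ 0ₚ | T? (isNonzeroQR p (toℕ a))
  ... | yes refl | _      = trans fibre-0ₚ (sym (cong₂ (λ d q → d + + 2 * q) (δ-refl 0ₚ) qrIndicator-0ₚ))
  ... | no a≢0   | yes qr = trans (fibre-square qr) (sym (cong₂ (λ d q → d + + 2 * q) (δ-≢ (a≢0 ∘ sym)) (boolToℤ-T qr)))
  ... | no a≢0   | no ¬qr =
    trans (fibre-nonsquare a≢0 ¬qr) (sym (cong₂ (λ d q → d + + 2 * q) (δ-≢ (a≢0 ∘ sym)) (boolToℤ-¬T ¬qr)))

  qrIndicator-count : + 1 + + 2 * sum qrIndicator ≡ + p
  qrIndicator-count = begin
    + 1 + + 2 * sum qrIndicator
      ≡⟨ cong₂ _+_ (sym (sum-δ 0ₚ)) (*-distribˡ-sum (+ 2) qrIndicator) ⟩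
    sum (δ 0ₚ) + sum (λ a → + 2 * qrIndicator a)      ≡⟨ ∑-distrib-+ (δ 0ₚ) (λ a → + 2 * qrIndicator a) ⟨
    sum (λ a → δ 0ₚ a + + 2 * qrIndicator a)          ≡⟨ sum-cong-≗ square-fibre ⟨
    sum (λ a → sum (λ y → δ (square y) a))            ≡⟨ ∑-comm (λ y a → δ (square y) a) ⟨
    sum (λ y → sum (δ (square y)))                    ≡⟨ sum-cong-≗ (λ y → sum-δ (square y)) ⟩
    sum (λ (_ : Fin p) → + 1)                         ≡⟨ sum-const p 1 ⟩
    + (p ℕ.* 1)                                       ≡⟨ cong +_ (ℕP.*-identityʳ p) ⟩
    + p                                               ∎
    where
    open ≡-Reasoning
    sum-δ : ∀ k → sum (δ k) ≡ + 1
    sum-δ k = trans (sum-cong-≗ (λ j → sym (ℤP.*-identityʳ (δ k j)))) (sum-δˡ k (λ _ → + 1))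

  inverse-exists : ∀ {a} → a ≢ 0ₚ → ∃ λ z → ⟦ a ⟧ * z ≋ + 1
  inverse-exists {a} a≢0 = fromBézout (coprime-Bézout (prime⇒coprime p-prime {{nonZero}} (FinP.toℕ<n a)))
    where
    nonZero : ℕ.NonZero (toℕ a)
    nonZero = ℕ.≢-nonZero (λ a≡0 → a≢0 (≋0⇒≡0ₚ (≡⇒≋ (cong +_ a≡0))))
    fromBézout : Bézout.Identity 1 p (toℕ a) → ∃ λ z → ⟦ a ⟧ * z ≋ + 1
    fromBézout (Bézout.+- x y eq) = - + y , mk≋ (divides (- + x) (begin
      ⟦ a ⟧ * - + y - + 1          ≡⟨ regroup ⟦ a ⟧ (+ y) ⟩
      - (+ 1 + + y * ⟦ a ⟧)
        ≡⟨ cong -_ (trans (ℤP.pos-+ 1 (y ℕ.* toℕ a)) (cong (_+_ (+ 1)) (ℤP.pos-* y (toℕ a)))) ⟨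
      - + (1 ℕ.+ y ℕ.* toℕ a)      ≡⟨ cong (λ k → - + k) eq ⟩
      - + (x ℕ.* p)                ≡⟨ cong -_ (ℤP.pos-* x p) ⟩
      - (+ x * + p)                ≡⟨ ℤP.neg-distribˡ-* (+ x) (+ p) ⟩
      - + x * + p                  ∎))
      where
      open ≡-Reasoning
      regroup : ∀ a y → a * - y - + 1 ≡ - (+ 1 + y * a)
      regroup = solve-∀
    fromBézout (Bézout.-+ x y eq) = + y , mk≋ (divides (+ x) (begin
      ⟦ a ⟧ * + y - + 1            ≡⟨ regroup ⟦ a ⟧ (+ y) ⟩
      + y * ⟦ a ⟧ - + 1            ≡⟨ cong (_- + 1) (trans (sym (ℤP.pos-* y (toℕ a))) (cong +_ (sym eq))) ⟩
      + (1 ℕ.+ x ℕ.* p) - + 1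
        ≡⟨ cong (_- + 1) (trans (ℤP.pos-+ 1 (x ℕ.* p)) (cong (_+_ (+ 1)) (ℤP.pos-* x p))) ⟩
      + 1 + + x * + p - + 1        ≡⟨ cancel (+ x * + p) ⟩
      + x * + p                    ∎))
      where
      open ≡-Reasoning
      regroup : ∀ a y → a * y - + 1 ≡ y * a - + 1
      regroup = solve-∀
      cancel : ∀ z → + 1 + z - + 1 ≡ z
      cancel = solve-∀

  private
    inverseOf : ∀ a → Dec (a ≡ 0ₚ) → Fin p
    inverseOf a (yes _)   = 0ₚ
    inverseOf a (no a≢0)  = residue (proj₁ (inverse-exists a≢0))

  inverse : Fin p → Fin p
  inverse a = inverseOf a (a Fin.≟ 0ₚ)

  inverse-0ₚ : ∀ {a} → a ≡ 0ₚ → inverse a ≡ 0ₚ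
  inverse-0ₚ {a} a≡0 = inverseOf-0ₚ (a Fin.≟ 0ₚ)
    where
    inverseOf-0ₚ : ∀ d → inverseOf a d ≡ 0ₚ
    inverseOf-0ₚ (yes _)   = refl
    inverseOf-0ₚ (no a≢0)  = ⊥-elim (a≢0 a≡0)

  inverse-inverts : ∀ {a} → a ≢ 0ₚ → ⟦ a ⟧ * ⟦ inverse a ⟧ ≋ + 1
  inverse-inverts {a} a≢0 = inverts (a Fin.≟ 0ₚ)
    where
    inverts : ∀ d → ⟦ a ⟧ * ⟦ inverseOf a d ⟧ ≋ + 1
    inverts (yes a≡0) = ⊥-elim (a≢0 a≡0)
    inverts (no a≢0′) =
      ≋-trans (*-congˡ ⟦ a ⟧ (residue-≋ (proj₁ (inverse-exists a≢0′)))) (proj₂ (inverse-exists a≢0′))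

  inverse-unique : ∀ {a b c} → a ≢ 0ₚ → ⟦ a ⟧ * ⟦ b ⟧ ≋ + 1 → ⟦ a ⟧ * ⟦ c ⟧ ≋ + 1 → b ≡ c
  inverse-unique {a} {b} {c} a≢0 ab≋1 ac≋1 =
    [ (λ a≋0 → ⊥-elim (a≢0 (≋0⇒≡0ₚ a≋0))) , (λ b-c≋0 → ⟦⟧-injective {b} {c} (-≋0⇒≋ {⟦ b ⟧} {⟦ c ⟧} b-c≋0)) ]′
      (euclid ⟦ a ⟧ (⟦ b ⟧ - ⟦ c ⟧) a[b-c]≋0)
    where
    distrib : ∀ a b c → a * (b - c) ≡ a * b - a * c
    distrib = solve-∀
    a[b-c]≋0 : ⟦ a ⟧ * (⟦ b ⟧ - ⟦ c ⟧) ≋ + 0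
    a[b-c]≋0 = ≋-trans (≡⇒≋ (distrib ⟦ a ⟧ ⟦ b ⟧ ⟦ c ⟧))
                       (≋⇒-≋0 {⟦ a ⟧ * ⟦ b ⟧} {⟦ a ⟧ * ⟦ c ⟧} (≋-trans ab≋1 (≋-sym ac≋1)))

  inverse-≢0ₚ : ∀ {a} → a ≢ 0ₚ → inverse a ≢ 0ₚ
  inverse-≢0ₚ {a} a≢0 inv≡0 = 1≉0 (≋-trans (≋-sym (inverse-inverts a≢0))
    (≋-trans (*-congˡ ⟦ a ⟧ (≋-trans (≡⇒≋ (cong ⟦_⟧ inv≡0)) 0ₚ-≋)) (≡⇒≋ (ℤP.*-zeroʳ ⟦ a ⟧))))

  inverse-involutive : ∀ a → inverse (inverse a) ≡ a
  inverse-involutive a = involutive (a Fin.≟ 0ₚ)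
    where
    involutive : Dec (a ≡ 0ₚ) → inverse (inverse a) ≡ a
    involutive (yes a≡0) = trans (inverse-0ₚ (inverse-0ₚ a≡0)) (sym a≡0)
    involutive (no a≢0)  = inverse-unique (inverse-≢0ₚ a≢0) (inverse-inverts (inverse-≢0ₚ a≢0))
                         (≋-trans (≡⇒≋ (ℤP.*-comm ⟦ inverse a ⟧ ⟦ a ⟧)) (inverse-inverts a≢0))

  private
    ≢0ₚ : ∀ {a} → ¬ (⟦ a ⟧ ≋ + 0) → a ≢ 0ₚ
    ≢0ₚ a≉0 a≡0 = a≉0 (subst (λ b → ⟦ b ⟧ ≋ + 0) (sym a≡0) 0ₚ-≋)

    inverse-square : ∀ a → T (isNonzeroQR p (toℕ a)) → T (isNonzeroQR p (toℕ (inverse a)))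
    inverse-square a qr = fromRoot (isNonzeroQR-sound (toℕ a) qr)
      where
      fromRoot : IsNonzeroSquare ⟦ a ⟧ → T (isNonzeroQR p (toℕ (inverse a)))
      fromRoot (a≉0 , y , y²≋a) = isNonzeroQR-complete _ (inv≉0 , t * y , root)
        where
        t = ⟦ inverse a ⟧
        inv≉0 : ¬ (t ≋ + 0)
        inv≉0 t≋0 = inverse-≢0ₚ (≢0ₚ a≉0) (≋0⇒≡0ₚ t≋0)
        regroup : ∀ t y → (t * y) * (t * y) ≡ t * (t * (y * y))
        regroup = solve-∀
        root : (t * y) * (t * y) ≋ t
        root = ≋-trans (≡⇒≋ (regroup t y)) (≋-trans (*-congˡ t (*-congˡ t y²≋a))
                 (≋-trans (*-congˡ t (≋-trans (≡⇒≋ (ℤP.*-comm t ⟦ a ⟧)) (inverse-inverts (≢0ₚ a≉0))))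
                          (≡⇒≋ (ℤP.*-identityʳ t))))

  qrIndicator-inverse : ∀ a → qrIndicator (inverse a) ≡ qrIndicator a
  qrIndicator-inverse a = cong boolToℤ (T-injective
    (λ t → subst (λ b → T (isNonzeroQR p (toℕ b))) (inverse-involutive a) (inverse-square (inverse a) t))
    (inverse-square a))

  inverse-fixed : ∀ {a} → a ≢ 0ₚ → inverse a ≡ a → a ≡ 1ₚ ⊎ a ≡ -1ₚ
  inverse-fixed {a} a≢0 fixed = Sum.map (λ a≋1 → sym (residue-unique {a} a≋1)) (λ a≋-1 → sym (residue-unique {a} a≋-1))
    (square-roots ⟦ a ⟧ (+ 1) (subst (λ b → ⟦ a ⟧ * ⟦ b ⟧ ≋ + 1) fixed (inverse-inverts a≢0)))

  private
    1ₚ-≋ : ⟦ 1ₚ ⟧ ≋ + 1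
    1ₚ-≋ = residue-≋ (+ 1)

    -1ₚ-≋ : ⟦ -1ₚ ⟧ ≋ - + 1
    -1ₚ-≋ = residue-≋ (- + 1)

    1ₚ≢0ₚ : 1ₚ ≢ 0ₚ
    1ₚ≢0ₚ 1≡0 = 1≉0 (≋-trans (≋-sym 1ₚ-≋) (≋-trans (≡⇒≋ (cong ⟦_⟧ 1≡0)) 0ₚ-≋))

    -1ₚ≢0ₚ : -1ₚ ≢ 0ₚ
    -1ₚ≢0ₚ -1≡0 = 1≉0 (neg-cong (≋-trans (≋-sym -1ₚ-≋) (≋-trans (≡⇒≋ (cong ⟦_⟧ -1≡0)) 0ₚ-≋)))

    1ₚ≢-1ₚ : 1ₚ ≢ -1ₚ
    1ₚ≢-1ₚ 1≡-1 = 2≉0 (≋⇒-≋0 (≋-trans (≋-sym 1ₚ-≋) (≋-trans (≡⇒≋ (cong ⟦_⟧ 1≡-1)) -1ₚ-≋)))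

    inverse-±1ₚ : ∀ {a} → a ≢ 0ₚ → ⟦ a ⟧ * ⟦ a ⟧ ≋ + 1 → inverse a ≡ a
    inverse-±1ₚ a≢0 a²≋1 = inverse-unique a≢0 (inverse-inverts a≢0) a²≋1

    qrIndicator-1ₚ : qrIndicator 1ₚ ≡ + 1
    qrIndicator-1ₚ =
      boolToℤ-T (isNonzeroQR-complete _ ((λ 1≋0 → 1≉0 (≋-trans (≋-sym 1ₚ-≋) 1≋0)) , + 1 , ≋-sym 1ₚ-≋))

  fixedPoint-sum : sum (λ a → qrIndicator a * δ (inverse a) a) ≡ + 1 + qrIndicator -1ₚ
  fixedPoint-sum = begin
    sum (λ a → qrIndicator a * δ (inverse a) a)
      ≡⟨ sum-pair (λ a → qrIndicator a * δ (inverse a) a) 1ₚ≢-1ₚ vanish ⟩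
    qrIndicator 1ₚ * δ (inverse 1ₚ) 1ₚ + qrIndicator -1ₚ * δ (inverse -1ₚ) -1ₚ
      ≡⟨ cong₂ (λ x y → x * δ y 1ₚ + qrIndicator -1ₚ * δ (inverse -1ₚ) -1ₚ) qrIndicator-1ₚ
               (inverse-±1ₚ 1ₚ≢0ₚ (*-cong 1ₚ-≋ 1ₚ-≋)) ⟩
    + 1 * δ 1ₚ 1ₚ + qrIndicator -1ₚ * δ (inverse -1ₚ) -1ₚ
      ≡⟨ cong₂ (λ x y → + 1 * x + qrIndicator -1ₚ * δ y -1ₚ) (δ-refl 1ₚ)
               (inverse-±1ₚ -1ₚ≢0ₚ (*-cong -1ₚ-≋ -1ₚ-≋)) ⟩
    + 1 * + 1 + qrIndicator -1ₚ * δ -1ₚ -1ₚ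
      ≡⟨ cong (λ x → + 1 + qrIndicator -1ₚ * x) (δ-refl -1ₚ) ⟩
    + 1 + qrIndicator -1ₚ * + 1
      ≡⟨ cong (_+_ (+ 1)) (ℤP.*-identityʳ (qrIndicator -1ₚ)) ⟩
    + 1 + qrIndicator -1ₚ  ∎
    where
    open ≡-Reasoning
    vanish : ∀ a → a ≢ 1ₚ → a ≢ -1ₚ → qrIndicator a * δ (inverse a) a ≡ + 0
    vanish a a≢1 a≢-1 = vanishes (a Fin.≟ 0ₚ) (inverse a Fin.≟ a)
      where
      vanishes : Dec (a ≡ 0ₚ) → Dec (inverse a ≡ a) → qrIndicator a * δ (inverse a) a ≡ + 0
      vanishes (yes a≡0) _           = trans (cong (_* δ (inverse a) a) (trans (cong qrIndicator a≡0) qrIndicator-0ₚ))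
                                           (ℤP.*-zeroˡ (δ (inverse a) a))
      vanishes (no a≢0)  (yes fixed) = ⊥-elim ([ a≢1 , a≢-1 ]′ (inverse-fixed a≢0 fixed))
      vanishes (no a≢0)  (no ¬fixed) = trans (cong (qrIndicator a *_) (δ-≢ ¬fixed)) (ℤP.*-zeroʳ (qrIndicator a))

  private
    parity : ∀ x y → + 2 * x ≢ + 1 + + 2 * y
    parity x y eq = 2≢1 (ℕP.m*n≡1⇒m≡1 2 ℤ.∣ x - y ∣ (trans (sym (ℤP.abs-* (+ 2) (x - y))) (cong ℤ.∣_∣ odd)))
      where
      2≢1 : 2 ≢ 1
      2≢1 ()
      distrib : ∀ x y → + 2 * (x - y) ≡ + 2 * x - + 2 * y
      distrib = solve-∀
      cancel : ∀ y → + 1 + + 2 * y - + 2 * y ≡ + 1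
      cancel = solve-∀
      odd : + 2 * (x - y) ≡ + 1
      odd = trans (distrib x y) (trans (cong (_- + 2 * y) eq) (cancel y))

  -- Inversion permutes the 2k nonzero squares and fixes only 1 and, if it is a square,
  -- -1; an odd number of fixed points would contradict parity.
  -1-isSquare : ∀ k → sum qrIndicator ≡ + 2 * + k → ∃ λ i → i * i ≋ - + 1
  -1-isSquare k count with T? (isNonzeroQR p (toℕ -1ₚ))
  ... | yes qr = proj₁ (proj₂ (isNonzeroQR-sound _ qr)) , ≋-trans (proj₂ (proj₂ (isNonzeroQR-sound _ qr))) -1ₚ-≋
  ... | no ¬qr = ⊥-elim (parity (+ k) L (begin
    + 2 * + k                                                      ≡⟨ count ⟨
    sum qrIndicator                                                ≡⟨ sum≡ ⟩
    sum (λ a → qrIndicator a * δ (inverse a) a) + + 2 * L          ≡⟨ cong (_+ + 2 * L) fixedPoint-sum ⟩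
    + 1 + qrIndicator -1ₚ + + 2 * L
      ≡⟨ cong (λ q → + 1 + q + + 2 * L) (boolToℤ-¬T ¬qr) ⟩
    + 1 + + 2 * L                                                  ∎))
    where
    open ≡-Reasoning
    parityDecomposition = sum-involution-parity inverse inverse-involutive qrIndicator qrIndicator-inverse
    L = proj₁ parityDecomposition
    sum≡ = proj₂ parityDecomposition

  IsNonzeroSquare-neg : ∀ {z} → (∃ λ i → i * i ≋ - + 1) → IsNonzeroSquare z → IsNonzeroSquare (- z)
  IsNonzeroSquare-neg {z} (i , i²≋-1) (z≉0 , y , y²≋z) =
    (λ -z≋0 → z≉0 (≋-trans (≡⇒≋ (sym (ℤP.neg-involutive z))) (neg-cong -z≋0))) , i * y , root
    where
    regroup : ∀ i y → (i * y) * (i * y) ≡ (i * i) * (y * y)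
    regroup = solve-∀
    root : (i * y) * (i * y) ≋ - z
    root = ≋-trans (≡⇒≋ (regroup i y)) (≋-trans (*-cong i²≋-1 y²≋z) (≡⇒≋ (ℤP.-1*i≡-i z)))


-- Paley graphs

module Paley (p : ℕ) (p-prime : Prime p) (k : ℕ) (p≡1+4k : p ≡ 1 ℕ.+ 4 ℕ.* k) (2<p : 2 ℕ.< p) where
  open QuadraticResidues p p-prime 2<p

  qrIndicator-sum : sum qrIndicator ≡ + 2 * + k
  qrIndicator-sum = ℤP.*-cancelˡ-≡ (+ 2) _ _ (∙-cancelˡ (+ 1) _ _ (begin
    + 1 + + 2 * sum qrIndicator     ≡⟨ qrIndicator-count ⟩
    + p                             ≡⟨ cong +_ p≡1+4k ⟩
    + (1 ℕ.+ 4 ℕ.* k)               ≡⟨ trans (ℤP.pos-+ 1 (4 ℕ.* k)) (cong (_+_ (+ 1)) (ℤP.pos-* 4 k)) ⟩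
    + 1 + + 4 * + k                 ≡⟨ cong (_+_ (+ 1)) (ℤP.*-assoc (+ 2) (+ 2) (+ k)) ⟩
    + 1 + + 2 * (+ 2 * + k)         ∎))
    where open ≡-Reasoning

  private
    -1-square : ∃ λ i → i * i ≋ - + 1
    -1-square = -1-isSquare k qrIndicator-sum

    difference : Fin p → Fin p → ℕ
    difference x y = (toℕ x ℕ.+ (p ℕ.∸ toℕ y)) % p

    difference-≋ : ∀ x y → + difference x y ≋ ⟦ x ⟧ - ⟦ y ⟧
    difference-≋ x y =
      ≋-trans (%-≋ _)
      (≋-trans (≡⇒≋ (trans (ℤP.pos-+ (toℕ x) _) (cong (_+_ ⟦ x ⟧) p-y)))
      (≋-trans (+-congˡ ⟦ x ⟧ (+-congʳ (- ⟦ y ⟧) p≋0))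
               (≡⇒≋ (cong (_+_ ⟦ x ⟧) (ℤP.+-identityˡ (- ⟦ y ⟧))))))
      where
      p-y : + (p ℕ.∸ toℕ y) ≡ + p - ⟦ y ⟧
      p-y = sym (trans (ℤP.m-n≡m⊖n p (toℕ y)) (ℤP.⊖-≥ (ℕP.<⇒≤ (FinP.toℕ<n y))))

    isNonzeroQR-neg : ∀ {m n} → + n ≋ - + m → isNonzeroQR p m ≡ isNonzeroQR p n
    isNonzeroQR-neg {m} {n} n≋-m = T-injective
      (λ t → isNonzeroQR-complete n (IsNonzeroSquare-resp (≋-sym n≋-m) (IsNonzeroSquare-neg -1-square (isNonzeroQR-sound m t))))
      (λ t → isNonzeroQR-complete m (IsNonzeroSquare-resp -n≋m (IsNonzeroSquare-neg -1-square (isNonzeroQR-sound n t))))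
      where
      -n≋m : - + n ≋ + m
      -n≋m = ≋-trans (neg-cong n≋-m) (≡⇒≋ (ℤP.neg-involutive (+ m)))

  paley-symmetric : Symmetric (paley p)
  paley-symmetric x y = cong₂ _∧_ (cong not (==ᶠ-sym x y)) (isNonzeroQR-neg
    (≋-trans (difference-≋ y x) (≋-trans (≡⇒≋ (flip ⟦ y ⟧ ⟦ x ⟧)) (neg-cong (≋-sym (difference-≋ x y))))))
    where
    flip : ∀ a b → a - b ≡ - (b - a)
    flip = solve-∀

  private
    shift : Fin p → Fin p → Fin p
    shift u v = residue (⟦ u ⟧ - ⟦ v ⟧)

    shift-involutive : ∀ u v → shift u (shift u v) ≡ v
    shift-involutive u v = residue-unique (≋-trans (≡⇒≋ (cancel ⟦ u ⟧ ⟦ v ⟧))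
                             (+-congˡ ⟦ u ⟧ (neg-cong (≋-sym (residue-≋ (⟦ u ⟧ - ⟦ v ⟧))))))
      where
      cancel : ∀ u v → v ≡ u - (u - v)
      cancel = solve-∀

    paley-entry : ∀ u v → adjMatrix (paley p) u v ≡ qrIndicator (shift u v)
    paley-entry u v = entry (u Fin.≟ v)
      where
      entry : Dec (u ≡ v) → adjMatrix (paley p) u v ≡ qrIndicator (shift u v)
      entry (yes refl) = trans (cong (λ b → boolToℤ (not b ∧ isNonzeroQR p (difference u u))) (==ᶠ-refl u))
                                (sym (trans (cong qrIndicator shift-self) qrIndicator-0ₚ))
        where
        shift-self : shift u u ≡ 0ₚ
        shift-self = ≋0⇒≡0ₚ (≋-trans (residue-≋ (⟦ u ⟧ - ⟦ u ⟧)) (≡⇒≋ (ℤP.+-inverseʳ ⟦ u ⟧)))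
      entry (no u≢v)   = trans (cong (λ b → boolToℤ (not b ∧ isNonzeroQR p (difference u v))) (≢⇒==ᶠ-false u≢v))
                                (cong boolToℤ (isNonzeroQR-cong (≋-trans (difference-≋ u v) (≋-sym (residue-≋ _)))))

  paley-regular : Regular (2 ℕ.* k) (paley p)
  paley-regular u = begin
    sum (adjMatrix (paley p) u)             ≡⟨ sum-cong-≗ (paley-entry u) ⟩
    sum (qrIndicator ∘ shift u)             ≡⟨ sum-involution (shift u) (shift-involutive u) qrIndicator ⟨
    sum qrIndicator                         ≡⟨ qrIndicator-sum ⟩
    + 2 * + k                               ≡⟨ ℤP.pos-* 2 k ⟨
    + (2 ℕ.* k)                             ∎
    where open ≡-Reasoning


-- The lift of the Paley graph

half-4k : ∀ k → (4 ℕ.* k) / 2 ≡ 2 ℕ.* k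
half-4k k = trans (cong (_/ 2) (double k)) (m*n/n≡m (2 ℕ.* k) 2)
  where
  double : ∀ k → 4 ℕ.* k ≡ 2 ℕ.* k ℕ.* 2
  double = ℕ-Solver.solve-∀

paley-HLsize-split : ∀ k → 1 ℕ.≤ k → let p = 1 ℕ.+ 4 ℕ.* k in
                     p *ℕ ((p ∸ 1) / 2) ≡ (p ℕ.+ p) ℕ.+ (((p *ℕ (p ∸ 1)) / 2) ∸ (2 *ℕ p))
paley-HLsize-split k 1≤k = begin
  p *ℕ ((4 ℕ.* k) / 2)                            ≡⟨ cong (p *ℕ_) (half-4k k) ⟩
  p *ℕ (2 ℕ.* k)                                  ≡⟨ ℕP.m+[n∸m]≡n 2p≤p2k ⟨
  2 *ℕ p ℕ.+ (p *ℕ (2 ℕ.* k) ∸ 2 *ℕ p)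
    ≡⟨ cong₂ (λ a b → a ℕ.+ (b ∸ 2 *ℕ p)) (double p) (sym halve) ⟩
  (p ℕ.+ p) ℕ.+ (((p *ℕ (4 ℕ.* k)) / 2) ∸ (2 *ℕ p))  ∎
  where
  open ≡-Reasoning
  p = 1 ℕ.+ 4 ℕ.* k
  double : ∀ p → 2 ℕ.* p ≡ p ℕ.+ p
  double = ℕ-Solver.solve-∀
  halve : (p *ℕ (4 ℕ.* k)) / 2 ≡ p *ℕ (2 ℕ.* k)
  halve = trans (cong (_/ 2) (regroup p k)) (m*n/n≡m (p *ℕ (2 ℕ.* k)) 2)
    where
    regroup : ∀ p k → p ℕ.* (4 ℕ.* k) ≡ p ℕ.* (2 ℕ.* k) ℕ.* 2
    regroup = ℕ-Solver.solve-∀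
  2p≤p2k : 2 *ℕ p ℕ.≤ p *ℕ (2 ℕ.* k)
  2p≤p2k = subst (ℕ._≤ p *ℕ (2 ℕ.* k)) (ℕP.*-identityʳ (2 *ℕ p))
             (subst (2 *ℕ p ℕ.* 1 ℕ.≤_) (regroup p k) (ℕP.*-monoʳ-≤ (2 *ℕ p) 1≤k))
    where
    regroup : ∀ p k → 2 ℕ.* p ℕ.* k ≡ p ℕ.* (2 ℕ.* k)
    regroup = ℕ-Solver.solve-∀

mainTheorem19 : (p : ℕ) .{{_ : NonZero p}} → Prime p → p % 4 ≡ 1 →
    ∀ (x : ℤ) →
      charPoly (adjMatrix (HL2 (paley p))) x
        ≡ ((x + + 2) ^ℤ (((p *ℕ (p ∸ 1)) / 2) ∸ (2 *ℕ p)))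
          * charPoly (adjMatrix (paley p)) (x - + ((p ∸ 1) / 2) + + 2)
          * (((- + 1) ^ℤ p) * charPoly (adjMatrix (paley p)) (- (x - + ((p ∸ 1) / 2) + + 2)))
mainTheorem19 p {{p≢0}} p-prime p%4≡1 x = charPoly-HL2 (paley p {{p≢0}}) paley-symmetric regular size x
  where
  k = p / 4
  p≡1+4k : p ≡ 1 ℕ.+ 4 ℕ.* k
  p≡1+4k = trans (m≡m%n+[m/n]*n p 4) (cong₂ ℕ._+_ p%4≡1 (ℕP.*-comm k 4))
  1≤k : 1 ℕ.≤ k
  1≤k = ℕP.n≢0⇒n>0 (λ k≡0 → ¬prime[1] (subst Prime (trans p≡1+4k (cong (λ k → 1 ℕ.+ 4 ℕ.* k) k≡0)) p-prime))
  2<p : 2 ℕ.< p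
  2<p = subst (2 ℕ.<_) (sym p≡1+4k)
              (ℕP.≤-trans (ℕ.s≤s (ℕ.s≤s (ℕ.s≤s ℕ.z≤n))) (ℕ.s≤s (ℕP.*-monoʳ-≤ 4 1≤k)))
  open Paley p p-prime k p≡1+4k 2<p using (paley-symmetric; paley-regular)
  regular : Regular ((p ∸ 1) / 2) (paley p)
  regular = subst (λ d → Regular d (paley p))
                  (sym (trans (cong (λ q → (q ∸ 1) / 2) p≡1+4k) (half-4k k))) paley-regular
  size : HLsize (paley p) ≡ (p ℕ.+ p) ℕ.+ (((p *ℕ (p ∸ 1)) / 2) ∸ (2 *ℕ p))
  size = trans (Lift.HLsize-regular (paley p) regular)
               (subst (λ q → q *ℕ ((q ∸ 1) / 2) ≡ (q ℕ.+ q) ℕ.+ (((q *ℕ (q ∸ 1)) / 2) ∸ (2 *ℕ q)))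
                      (sym p≡1+4k) (paley-HLsize-split k 1≤k))
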